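{- Let $P$ be a bounded, ranked poset of length $n\ge1$ and let $t$ be a positive integer. Then \[\sum_{j=1}^n\mu\big(\widehat{I_j(P)}\big)t^j=-\mu\big((P^\ast\ast T_{t,n})^+\big),\] where $P^\ast$ is the dual of $P$.
   Context: For a bounded poset $X$, $\mu(X)=\mu_X(\hat0_X,\hat1_X)$ is its Möbius invariant. For a poset $X$, $\widehat X$ is $X$ with a new minimum and a new maximum adjoined, and $X^+$ is $X$ with only a new maximum adjoined. $P^-=P\setminus\{\hat0_P\}$. $C_n$ is the chain $1<2<\dots<n$. $T_{t,n}$ is a poset whose Hasse diagram is a complete $t$-ary tree of height $n$ (every non-leaf has exactly $t$ children, all leaves at distance $n$ from the root) with the root at the bottom. For ranked posets $X,Y$ with rank functions $r_X,r_Y$ (normalized so that minimal elements have rank $0$), the Rees product $X\ast Y=\{(x,y)\in X\times Y: r_X(x)\ge r_Y(y)\}$ with $(x_1,y_1)\le(x_2,y_2)$ iff $x_1\le x_2$, $y_1\le y_2$ and $r_X(x_2)-r_X(x_1)\ge r_Y(y_2)-r_Y(y_1)$. For $j\in[n]$, $I_j(P)=\{z\in P^-\ast C_n: z<(\hat1_P,j)\}$. -}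

module Defs where

open import Data.Nat as ℕ using (ℕ; zero; suc; _∸_)
import Data.Nat.Properties as ℕP
open import Data.Integer as ℤ using (ℤ; +_; -_; _-_)
import Data.Integer.Properties as ℤP
open import Data.Fin as Fin using (Fin; toℕ)
import Data.Fin.Properties as FinP
open import Data.List using (List; []; _∷_; map; filter; cartesianProduct; concatMap; allFin; foldr; length; upTo)
import Data.List.Properties as ListP
open import Data.List.Relation.Binary.Prefix.Heterogeneous using (Prefix)
open import Data.List.Relation.Binary.Prefix.Heterogeneous.Properties using (prefix?)
open import Data.Maybe using (Maybe; just; nothing)
import Data.Maybe.Properties as MaybeP
open import Data.Product using (_×_; _,_; proj₁; proj₂)
import Data.Product.Properties as ProdP
open import Data.Product.Relation.Binary.Pointwise.NonDependent using ()
open import Relation.Nullary using (¬_; Dec; yes; no)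
open import Relation.Nullary.Decidable using (_×-dec_; ¬?)
open import Relation.Binary using (Decidable; DecidableEquality)
open import Relation.Binary.PropositionalEquality using (_≡_; refl)

-- Finite "poset data": a carrier, a duplicate-free list of its elements,
-- a decidable order relation and decidable equality.  (For the derived
-- posets below the partial-order / finiteness laws hold mathematically;
-- they are not needed to *state* the Möbius invariants.  For the given
-- poset P they are imposed as hypotheses in the theorem.)

record FinPoset : Set₁ where
  field
    Carrier : Set
    elems   : List Carrier
    _≤_     : Carrier → Carrier → Set
    _≤?_    : Decidable _≤_
    _≟_     : DecidableEquality Carrier

  _<_ : Carrier → Carrier → Set
  x < y = (x ≤ y) × ¬ (x ≡ y)

  _<?_ : Decidable _<_
  x <? y = (x ≤? y) ×-dec ¬? (x ≟ y)

  _⋖_ : Carrier → Carrier → Set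
  x ⋖ y = (x < y) × (∀ z → x < z → ¬ (z < y))

open FinPoset public

sumℤ : List ℤ → ℤ
sumℤ = foldr ℤ._+_ (+ 0)

-- Möbius function, by the defining recursion
--   μ(x,x) = 1,  μ(x,y) = - Σ_{x ≤ z < y} μ(x,z)  (x < y),  μ(x,y) = 0 otherwise.
-- The recursion is driven by a fuel argument; fuel = number of elements
-- suffices (every chain x = z₀ < … < y has fewer than #elems steps).

module _ (X : FinPoset) where
  private module X = FinPoset X

  mobiusFuel : ℕ → X.Carrier → X.Carrier → ℤ
  mobiusFuel zero    x y = + 0
  mobiusFuel (suc f) x y with x X.≟ y
  ... | yes _ = + 1
  ... | no  _ with x X.≤? y
  ...   | no  _ = + 0
  ...   | yes _ = - sumℤ (map (mobiusFuel f x)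
                          (filter (λ z → (x X.≤? z) ×-dec (z X.<? y)) X.elems))

  mobius : X.Carrier → X.Carrier → ℤ
  mobius = mobiusFuel (length X.elems)

dual : FinPoset → FinPoset
dual X = record
  { Carrier = Carrier X ; elems = elems X
  ; _≤_ = λ x y → _≤_ X y x ; _≤?_ = λ x y → _≤?_ X y x ; _≟_ = _≟_ X }

sub : (X : FinPoset) {S : Carrier X → Set} → (∀ x → Dec (S x)) → FinPoset
sub X S? = record
  { Carrier = Carrier X ; elems = filter S? (elems X)
  ; _≤_ = _≤_ X ; _≤?_ = _≤?_ X ; _≟_ = _≟_ X }

data Hat (A : Set) : Set where
  bot : Hat A
  top : Hat A
  inj : A → Hat A

data HatLe {A : Set} (R : A → A → Set) : Hat A → Hat A → Set where
  bot≤   : ∀ {y} → HatLe R bot y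
  ≤top   : ∀ {x} → HatLe R x top
  inj≤inj : ∀ {x y} → R x y → HatLe R (inj x) (inj y)

hat : FinPoset → FinPoset
hat X = record
  { Carrier = Hat (Carrier X)
  ; elems = bot ∷ top ∷ map inj (elems X)
  ; _≤_ = HatLe (_≤_ X) ; _≤?_ = le? ; _≟_ = eq? }
  where
  le? : Decidable (HatLe (_≤_ X))
  le? bot y = yes bot≤
  le? x top = yes ≤top
  le? top bot = no (λ ())
  le? top (inj _) = no (λ ())
  le? (inj x) bot = no (λ ())
  le? (inj x) (inj y) with _≤?_ X x y
  ... | yes p = yes (inj≤inj p)
  ... | no ¬p = no (λ { (inj≤inj p) → ¬p p })
  eq? : DecidableEquality (Hat (Carrier X))
  eq? bot bot = yes refl
  eq? bot top = no (λ ())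
  eq? bot (inj _) = no (λ ())
  eq? top bot = no (λ ())
  eq? top top = yes refl
  eq? top (inj _) = no (λ ())
  eq? (inj _) bot = no (λ ())
  eq? (inj _) top = no (λ ())
  eq? (inj x) (inj y) with _≟_ X x y
  ... | yes refl = yes refl
  ... | no ¬p = no (λ { refl → ¬p refl })

μhat : FinPoset → ℤ
μhat X = mobius (hat X) bot top

data PlusLe {A : Set} (R : A → A → Set) : Maybe A → Maybe A → Set where
  ≤new    : ∀ {x} → PlusLe R x nothing
  old≤old : ∀ {x y} → R x y → PlusLe R (just x) (just y)

plus : FinPoset → FinPoset
plus X = record
  { Carrier = Maybe (Carrier X)
  ; elems = nothing ∷ map just (elems X)
  ; _≤_ = PlusLe (_≤_ X) ; _≤?_ = le? ; _≟_ = MaybeP.≡-dec (_≟_ X) }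
  where
  le? : Decidable (PlusLe (_≤_ X))
  le? x nothing = yes ≤new
  le? nothing (just _) = no (λ ())
  le? (just x) (just y) with _≤?_ X x y
  ... | yes p = yes (old≤old p)
  ... | no ¬p = no (λ { (old≤old p) → ¬p p })

-- Rees product X ∗ Y of ranked posets with rank functions rX, rY
-- (normalised so that minimal elements have rank 0).
ReesLe : (X Y : FinPoset) (rX : Carrier X → ℕ) (rY : Carrier Y → ℕ) →
         Carrier X × Carrier Y → Carrier X × Carrier Y → Set
ReesLe X Y rX rY (x₁ , y₁) (x₂ , y₂) =
  _≤_ X x₁ x₂ × _≤_ Y y₁ y₂ ×
  ((+ rY y₂) - (+ rY y₁)) ℤ.≤ ((+ rX x₂) - (+ rX x₁))

rees : (X : FinPoset) → (Carrier X → ℕ) → (Y : FinPoset) → (Carrier Y → ℕ) → FinPoset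
rees X rX Y rY = record
  { Carrier = Carrier X × Carrier Y
  ; elems = filter (λ p → rY (proj₂ p) ℕP.≤? rX (proj₁ p))
                   (cartesianProduct (elems X) (elems Y))
  ; _≤_ = ReesLe X Y rX rY
  ; _≤?_ = λ { (x₁ , y₁) (x₂ , y₂) →
      _≤?_ X x₁ x₂ ×-dec _≤?_ Y y₁ y₂ ×-dec
      (((+ rY y₂) - (+ rY y₁)) ℤP.≤? ((+ rX x₂) - (+ rX x₁))) }
  ; _≟_ = ProdP.≡-dec (_≟_ X) (_≟_ Y) }

-- The chain C_n = 1 < 2 < … < n, element i ∈ Fin n standing for i+1;
-- its rank function is toℕ.
chain : ℕ → FinPoset
chain n = record
  { Carrier = Fin n ; elems = allFin n
  ; _≤_ = Fin._≤_ ; _≤?_ = FinP._≤?_ ; _≟_ = FinP._≟_ }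

-- The complete t-ary tree T_{t,n} of height n, root at the bottom:
-- nodes are words over Fin t of length ≤ n (paths from the root),
-- ordered by the prefix relation; rank = length.
wordsOfLength : (t : ℕ) → ℕ → List (List (Fin t))
wordsOfLength t zero    = [] ∷ []
wordsOfLength t (suc k) = concatMap (λ w → map (λ a → w Data.List.++ (a ∷ [])) (allFin t))
                                    (wordsOfLength t k)

tree : ℕ → ℕ → FinPoset
tree t n = record
  { Carrier = List (Fin t)
  ; elems = concatMap (wordsOfLength t) (upTo (suc n))
  ; _≤_ = Prefix _≡_
  ; _≤?_ = prefix? FinP._≟_
  ; _≟_ = ListP.≡-dec FinP._≟_ }

open import Data.List.Membership.Propositional using (_∈_)
open import Data.List.Relation.Unary.Unique.Propositional using (Unique)
open import Relation.Binary.Structures using (IsPartialOrder)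

record IsBoundedRankedFinPoset (P : FinPoset) (0̂ 1̂ : Carrier P)
                               (r : Carrier P → ℕ) (n : ℕ) : Set where
  field
    isPartialOrder : IsPartialOrder _≡_ (_≤_ P)
    complete       : ∀ x → x ∈ elems P
    unique         : Unique (elems P)
    0̂-min          : ∀ x → _≤_ P 0̂ x
    1̂-max          : ∀ x → _≤_ P x 1̂
    rank-0̂         : r 0̂ ≡ 0
    rank-cover     : ∀ x y → _⋖_ P x y → r y ≡ suc (r x)
    length≡n       : r 1̂ ≡ n

module _ (P : FinPoset) (0̂ 1̂ : Carrier P) (r : Carrier P → ℕ) (n : ℕ) where

  Pminus : FinPoset
  Pminus = sub P (λ x → ¬? (_≟_ P x 0̂))

  PminusC : FinPoset
  PminusC = rees Pminus (λ x → r x ∸ 1) (chain n) toℕ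

  -- I_j(P) = { z ∈ P⁻ ∗ C_n : z < (1̂, j) },  j ∈ Fin n standing for j+1
  I : Fin n → FinPoset
  I j = sub PminusC (λ z → _<?_ PminusC z (1̂ , j))

  PdualT : ℕ → FinPoset
  PdualT t = rees (dual P) (λ x → n ∸ r x) (tree t n) length

module Submission where

-- Write  S d = 1 + t + … + t^d  and  κ x y = [x < y] · S(r y - r x)  for x, y ∈ P.
-- Left side.  Let μ̂ be the Möbius function of  P⁻ ∗ C_n  (with a minimum adjoined) from its
-- minimum.  I_j is the down-set below (1̂, j), so μ(Î_j) = μ̂(1̂, j) and the left side is  t · D 1̂
-- with  D y = Σ_i t^i μ̂(y, i).  Summing the recursion of μ̂ over the levels of y, the elements
-- (y, i) above (x, h) form a window of levels, which gives  D y = -S(r y - 1) - Σ_x κ x y · D x.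
-- Right side.  q₀ = (1̂, root) is the least element of  Q = P* ∗ T_{t,n}, so  -μ(Q⁺) = Σ_x T x
-- with  T x = Σ_w μ_{Q⁺}(q₀, (x, w)).  Counting tree vertices above (y, u) gives
-- T x = [x = 1̂] - Σ_y κ x y · T y, and splitting off x = 0̂ gives  -μ(Q⁺) = -t Σ_{y ≠ 0̂} S(r y - 1) T y.
-- The two triangular systems with kernel κ pair off (∑-pairing), so the right side is  t · D 1̂ too.

open import Defs
open import Data.Nat using (ℕ; suc; _≥_; _^_)
open import Data.Integer using (ℤ; +_; -_; _*_)
open import Data.Fin using (Fin; toℕ)
open import Data.List using (List; []; _∷_; map; allFin)
open import Data.Maybe using (just; nothing)
open import Data.Product using (_,_)
open import Relation.Binary.PropositionalEquality using (_≡_)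

open import Data.Nat as ℕ using (zero; _∸_; z≤n; s≤s)
import Data.Nat.Properties as ℕP
open import Data.Integer as ℤ using (_-_)
import Data.Integer.Properties as ℤP
open import Data.Integer.Tactic.RingSolver using (solve-∀)
import Data.Fin.Properties as FinP
open import Data.List using (filter; cartesianProduct; concatMap; concat; length; upTo; applyUpTo; tabulate; _++_)
import Data.List.Properties as ListP
open import Data.List.Membership.Propositional using (_∈_; find; lose)
open import Data.List.Membership.Propositional.Properties
  using (∈-filter⁻; ∈-filter⁺; ∈-map⁺; ∈-map⁻; ∈-concatMap⁻; ∈-concatMap⁺; ∈-allFin; ∈-cartesianProduct⁺)
open import Data.List.Relation.Unary.Any using (here; there; any?)
import Data.List.Relation.Unary.All as All
import Data.List.Relation.Unary.AllPairs as AllPairs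
open import Data.List.Relation.Unary.Unique.Propositional using (Unique)
open import Data.List.Relation.Unary.Unique.Propositional.Properties using (allFin⁺; filter⁺)
open import Data.List.Relation.Binary.Pointwise using (Pointwise-≡⇒≡; ≡⇒Pointwise-≡)
open import Data.List.Relation.Binary.Prefix.Heterogeneous using (Prefix; []; _∷_)
open import Data.List.Relation.Binary.Prefix.Heterogeneous.Properties
  using (prefix?; length-mono; toPointwise; fromPointwise) renaming (trans to prefix-trans; antisym to prefix-antisym)
open import Data.Product using (_×_; proj₁; proj₂; ∃)
open import Data.Sum using (inj₁; inj₂)
open import Data.Empty using (⊥-elim)
open import Function using (_∘_; id)
open import Level using (0ℓ)
open import Relation.Nullary using (¬_; Dec; yes; no)
open import Relation.Nullary.Decidable using (_×-dec_; ¬?)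
open import Relation.Unary using (Pred)
open import Relation.Binary.PropositionalEquality using (refl; sym; trans; cong; cong₂; subst; subst₂; module ≡-Reasoning)
open import Relation.Binary.Structures using (IsPartialOrder)

ind : {A : Set} → Dec A → ℤ → ℤ
ind (yes _) x = x
ind (no _)  x = + 0

module _ {A : Set} where

  ind-yes : (d : Dec A) {x : ℤ} → A → ind d x ≡ x
  ind-yes (yes _) a = refl
  ind-yes (no ¬a) a = ⊥-elim (¬a a)

  ind-no : (d : Dec A) {x : ℤ} → ¬ A → ind d x ≡ + 0
  ind-no (yes a) ¬a = ⊥-elim (¬a a)
  ind-no (no _)  ¬a = refl

  ind-congʳ : (d : Dec A) {x y : ℤ} → (A → x ≡ y) → ind d x ≡ ind d y
  ind-congʳ (yes a) x≡y = x≡y a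
  ind-congʳ (no _)  x≡y = refl

  ind-0 : (d : Dec A) → ind d (+ 0) ≡ + 0
  ind-0 (yes _) = refl
  ind-0 (no _)  = refl

  ind-*ˡ : (d : Dec A) (c x : ℤ) → ind d (c ℤ.* x) ≡ c ℤ.* ind d x
  ind-*ˡ (yes _) c x = refl
  ind-*ˡ (no _)  c x = sym (ℤP.*-zeroʳ c)

  ind-*ʳ : (d : Dec A) (x c : ℤ) → ind d (x ℤ.* c) ≡ ind d x ℤ.* c
  ind-*ʳ (yes _) x c = refl
  ind-*ʳ (no _)  x c = refl

  ind-⇔ : {B : Set} (d : Dec A) (e : Dec B) {x y : ℤ} → (A → B) → (B → A) → x ≡ y → ind d x ≡ ind e y
  ind-⇔ (yes a) (yes b) f g x≡y = x≡y
  ind-⇔ (yes a) (no ¬b) f g x≡y = ⊥-elim (¬b (f a))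
  ind-⇔ (no ¬a) (yes b) f g x≡y = ⊥-elim (¬a (g b))
  ind-⇔ (no ¬a) (no ¬b) f g x≡y = refl

  ind-× : {B : Set} (d : Dec A) (e : Dec B) (x : ℤ) → ind (d ×-dec e) x ≡ ind d (ind e x)
  ind-× (yes a) (yes b) x = refl
  ind-× (yes a) (no ¬b) x = refl
  ind-× (no ¬a) e       x = refl

drop-zeroˡ : ∀ {a} b → a ≡ + 0 → a ℤ.+ b ≡ b
drop-zeroˡ b refl = ℤP.+-identityˡ b

∑ : {A : Set} → List A → (A → ℤ) → ℤ
∑ l f = sumℤ (map f l)

module _ {A : Set} where

  ∑-cong : (l : List A) {f g : A → ℤ} → (∀ a → a ∈ l → f a ≡ g a) → ∑ l f ≡ ∑ l g
  ∑-cong []      f≡g = refl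
  ∑-cong (a ∷ l) f≡g = cong₂ ℤ._+_ (f≡g a (here refl)) (∑-cong l (λ b b∈l → f≡g b (there b∈l)))

  ∑-cong′ : (l : List A) {f g : A → ℤ} → (∀ a → f a ≡ g a) → ∑ l f ≡ ∑ l g
  ∑-cong′ l f≡g = ∑-cong l (λ a _ → f≡g a)

  ∑-zero : (l : List A) {f : A → ℤ} → (∀ a → a ∈ l → f a ≡ + 0) → ∑ l f ≡ + 0
  ∑-zero []      f≡0 = refl
  ∑-zero (a ∷ l) f≡0 = cong₂ ℤ._+_ (f≡0 a (here refl)) (∑-zero l (λ b b∈l → f≡0 b (there b∈l)))

  ∑-+ : (l : List A) (f g : A → ℤ) → ∑ l (λ a → f a ℤ.+ g a) ≡ ∑ l f ℤ.+ ∑ l g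
  ∑-+ []      f g = refl
  ∑-+ (a ∷ l) f g = trans (cong (ℤ._+_ (f a ℤ.+ g a)) (∑-+ l f g)) (swap (f a) (g a) (∑ l f) (∑ l g))
    where
    swap : ∀ a b c d → (a ℤ.+ b) ℤ.+ (c ℤ.+ d) ≡ (a ℤ.+ c) ℤ.+ (b ℤ.+ d)
    swap = solve-∀

  ∑-*ˡ : (l : List A) (c : ℤ) (f : A → ℤ) → ∑ l (λ a → c ℤ.* f a) ≡ c ℤ.* ∑ l f
  ∑-*ˡ []      c f = sym (ℤP.*-zeroʳ c)
  ∑-*ˡ (a ∷ l) c f = trans (cong (ℤ._+_ (c ℤ.* f a)) (∑-*ˡ l c f)) (sym (ℤP.*-distribˡ-+ c (f a) (∑ l f)))

  ∑-*ʳ : (l : List A) (f : A → ℤ) (c : ℤ) → ∑ l (λ a → f a ℤ.* c) ≡ ∑ l f ℤ.* c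
  ∑-*ʳ l f c = trans (∑-cong′ l (λ a → ℤP.*-comm (f a) c)) (trans (∑-*ˡ l c f) (ℤP.*-comm c (∑ l f)))

  ∑-neg : (l : List A) (f : A → ℤ) → ∑ l (λ a → - f a) ≡ - ∑ l f
  ∑-neg []      f = refl
  ∑-neg (a ∷ l) f = trans (cong (ℤ._+_ (- f a)) (∑-neg l f)) (sym (ℤP.neg-distrib-+ (f a) (∑ l f)))

  -- The sum of  - f - g  (the shape produced by a Möbius recursion).
  ∑-neg-+ : (l : List A) (f g : A → ℤ) → ∑ l (λ a → - f a ℤ.+ - g a) ≡ - ∑ l f ℤ.+ - ∑ l g
  ∑-neg-+ l f g = trans (∑-+ l _ _) (cong₂ ℤ._+_ (∑-neg l f) (∑-neg l g))

  ∑-++ : (l k : List A) (f : A → ℤ) → ∑ (l ++ k) f ≡ ∑ l f ℤ.+ ∑ k f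
  ∑-++ []      k f = sym (ℤP.+-identityˡ _)
  ∑-++ (a ∷ l) k f = trans (cong (ℤ._+_ (f a)) (∑-++ l k f)) (sym (ℤP.+-assoc (f a) (∑ l f) (∑ k f)))

  ∑-filter : {P : Pred A 0ℓ} (p? : ∀ a → Dec (P a)) (l : List A) (f : A → ℤ) →
    ∑ (filter p? l) f ≡ ∑ l (λ a → ind (p? a) (f a))
  ∑-filter p? []      f = refl
  ∑-filter p? (a ∷ l) f with p? a
  ... | yes _ = cong (ℤ._+_ (f a)) (∑-filter p? l f)
  ... | no _  = trans (∑-filter p? l f) (sym (ℤP.+-identityˡ _))

  ∑-ind : {B : Set} (d : Dec B) (l : List A) (f : A → ℤ) → ∑ l (λ a → ind d (f a)) ≡ ind d (∑ l f)
  ∑-ind (yes _) l f = refl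
  ∑-ind (no _)  l f = ∑-zero l (λ _ _ → refl)

  ∑-split : (l : List A) (f : A → ℤ) {B : A → Set} (d : ∀ a → Dec (B a)) →
    ∑ l f ≡ ∑ l (λ a → ind (d a) (f a)) ℤ.+ ∑ l (λ a → ind (¬? (d a)) (f a))
  ∑-split l f d = trans (∑-cong′ l (λ a → split (d a))) (∑-+ l _ _)
    where
    split : ∀ {a} {B : Set} (e : Dec B) → f a ≡ ind e (f a) ℤ.+ ind (¬? e) (f a)
    split (yes _) = sym (ℤP.+-identityʳ _)
    split (no _)  = sym (ℤP.+-identityˡ _)

  ∑-delta : (l : List A) (a : A) (f : A → ℤ) → Unique l → a ∈ l →
    (∀ b → b ∈ l → ¬ b ≡ a → f b ≡ + 0) → ∑ l f ≡ f a
  ∑-delta (b ∷ l) a f (b∉l AllPairs.∷ u) (here refl) f≡0 =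
    trans (cong (ℤ._+_ (f b)) (∑-zero l (λ c c∈l → f≡0 c (there c∈l) (λ { refl → All.lookup b∉l c∈l refl }))))
          (ℤP.+-identityʳ _)
  ∑-delta (b ∷ l) a f (b∉l AllPairs.∷ u) (there a∈l) f≡0 =
    trans (cong (λ z → z ℤ.+ ∑ l f) (f≡0 b (here refl) (λ { refl → All.lookup b∉l a∈l refl })))
          (trans (ℤP.+-identityˡ _) (∑-delta l a f u a∈l (λ c c∈l → f≡0 c (there c∈l))))

∑-map : {A B : Set} (g : A → B) (l : List A) (f : B → ℤ) → ∑ (map g l) f ≡ ∑ l (f ∘ g)
∑-map g []      f = refl
∑-map g (a ∷ l) f = cong (ℤ._+_ (f (g a))) (∑-map g l f)

module _ {A B : Set} where

  ∑-concatMap : (g : A → List B) (l : List A) (f : B → ℤ) → ∑ (concatMap g l) f ≡ ∑ l (λ a → ∑ (g a) f)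
  ∑-concatMap g []      f = refl
  ∑-concatMap g (a ∷ l) f = trans (∑-++ (g a) (concat (map g l)) f) (cong (ℤ._+_ (∑ (g a) f)) (∑-concatMap g l f))

  ∑-cartesianProduct : (l : List A) (k : List B) (f : A × B → ℤ) →
    ∑ (cartesianProduct l k) f ≡ ∑ l (λ a → ∑ k (λ b → f (a , b)))
  ∑-cartesianProduct []      k f = refl
  ∑-cartesianProduct (a ∷ l) k f =
    trans (∑-++ (map (a ,_) k) _ f) (cong₂ ℤ._+_ (∑-map (a ,_) k f) (∑-cartesianProduct l k f))

  ∑-swap : (l : List A) (k : List B) (f : A → B → ℤ) → ∑ l (λ a → ∑ k (f a)) ≡ ∑ k (λ b → ∑ l (λ a → f a b))
  ∑-swap []      k f = sym (∑-zero k (λ _ _ → refl))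
  ∑-swap (a ∷ l) k f = trans (cong (ℤ._+_ (∑ k (f a))) (∑-swap l k f)) (sym (∑-+ k (f a) _))

∑-upTo-suc : (m : ℕ) (f : ℕ → ℤ) → ∑ (upTo (suc m)) f ≡ f 0 ℤ.+ ∑ (upTo m) (f ∘ suc)
∑-upTo-suc m f = cong (ℤ._+_ (f 0)) (trans (cong (λ l → ∑ l f) (sym (ListP.map-upTo suc m))) (∑-map suc (upTo m) f))

∑-allFin : (n : ℕ) (g : ℕ → ℤ) → ∑ (allFin n) (g ∘ toℕ) ≡ ∑ (upTo n) g
∑-allFin n g = trans (sym (∑-map toℕ (allFin n) g))
  (cong (λ l → ∑ l g) (trans (ListP.map-tabulate id toℕ) (tabulate-toℕ n id)))
  where
  tabulate-toℕ : ∀ n (h : ℕ → ℕ) → tabulate {n = n} (h ∘ toℕ) ≡ applyUpTo h n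
  tabulate-toℕ zero    h = refl
  tabulate-toℕ (suc n) h = cong (h 0 ∷_) (tabulate-toℕ n (h ∘ suc))

-- Pairing two triangular systems with the same kernel K (a finite "μ ζ = 1" argument):
-- if  D y = -s y - Σ_x K x y · D x  and  Σ_y K x y · T y = δ x - T x  on l, then
--   Σ_y s y · T y = -Σ_x D x · δ x.
∑-pairing : {A : Set} (l : List A) (K : A → A → ℤ) (D T s δ : A → ℤ) →
  (∀ y → y ∈ l → D y ≡ - s y ℤ.+ - ∑ l (λ x → K x y ℤ.* D x)) →
  (∀ x → x ∈ l → ∑ l (λ y → K x y ℤ.* T y) ≡ δ x ℤ.+ - T x) →
  ∑ l (λ y → s y ℤ.* T y) ≡ - ∑ l (λ x → D x ℤ.* δ x)
∑-pairing {A} l K D T s δ D-rec T-rec = begin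
  ∑ l (λ y → s y ℤ.* T y)
    ≡⟨ ∑-cong l (λ y y∈l → trans (cong (ℤ._* T y) (solve-for-s {s′ = s y} {KD y} (D-rec y y∈l)))
                                 (distrib (D y) (KD y) (T y))) ⟩
  ∑ l (λ y → - (D y ℤ.* T y) ℤ.+ - (KD y ℤ.* T y))
    ≡⟨ ∑-neg-+ l _ _ ⟩
  - ∑ l (λ y → D y ℤ.* T y) ℤ.+ - ∑ l (λ y → KD y ℤ.* T y)
    ≡⟨ cong (λ v → - ∑ l (λ y → D y ℤ.* T y) ℤ.+ - v) exchange ⟩
  - ∑ l (λ y → D y ℤ.* T y) ℤ.+ - (∑ l (λ x → D x ℤ.* δ x) ℤ.+ - ∑ l (λ x → D x ℤ.* T x))
    ≡⟨ cancel (∑ l (λ y → D y ℤ.* T y)) (∑ l (λ x → D x ℤ.* δ x)) ⟩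
  - ∑ l (λ x → D x ℤ.* δ x) ∎
  where
  open ≡-Reasoning
  KD : A → ℤ
  KD y = ∑ l (λ x → K x y ℤ.* D x)
  solve-for-s : ∀ {d s′ k} → d ≡ - s′ ℤ.+ - k → s′ ≡ - d ℤ.+ - k
  solve-for-s {s′ = s′} {k} refl = eq s′ k
    where
    eq : ∀ s k → s ≡ - (- s ℤ.+ - k) ℤ.+ - k
    eq = solve-∀
  distrib : ∀ d k τ → (- d ℤ.+ - k) ℤ.* τ ≡ - (d ℤ.* τ) ℤ.+ - (k ℤ.* τ)
  distrib = solve-∀
  cancel : ∀ a b → - a ℤ.+ - (b ℤ.+ - a) ≡ - b
  cancel = solve-∀
  rearrange : ∀ k d τ → k ℤ.* d ℤ.* τ ≡ d ℤ.* (k ℤ.* τ)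
  rearrange = solve-∀
  exchange : ∑ l (λ y → KD y ℤ.* T y) ≡ ∑ l (λ x → D x ℤ.* δ x) ℤ.+ - ∑ l (λ x → D x ℤ.* T x)
  exchange = begin
    ∑ l (λ y → KD y ℤ.* T y)
      ≡⟨ ∑-cong′ l (λ y → sym (∑-*ʳ l (λ x → K x y ℤ.* D x) (T y))) ⟩
    ∑ l (λ y → ∑ l (λ x → K x y ℤ.* D x ℤ.* T y))
      ≡⟨ ∑-swap l l _ ⟩
    ∑ l (λ x → ∑ l (λ y → K x y ℤ.* D x ℤ.* T y))
      ≡⟨ ∑-cong l (λ x x∈l → trans (∑-cong′ l (λ y → rearrange (K x y) (D x) (T y)))
           (trans (∑-*ˡ l (D x) _) (trans (cong (D x ℤ.*_) (T-rec x x∈l)) (ℤP.*-distribˡ-+ (D x) (δ x) (- T x))))) ⟩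
    ∑ l (λ x → D x ℤ.* δ x ℤ.+ D x ℤ.* - T x)
      ≡⟨ trans (∑-+ l _ _) (cong (ℤ._+_ (∑ l (λ x → D x ℤ.* δ x)))
           (trans (∑-cong′ l (λ x → sym (ℤP.neg-distribʳ-* (D x) (T x)))) (∑-neg l (λ x → D x ℤ.* T x)))) ⟩
    ∑ l (λ x → D x ℤ.* δ x) ℤ.+ - ∑ l (λ x → D x ℤ.* T x) ∎

record OrderLaws (X : FinPoset) : Set where
  field
    ≤-trans   : ∀ {a b c} → _≤_ X a b → _≤_ X b c → _≤_ X a c
    ≤-antisym : ∀ {a b} → _≤_ X a b → _≤_ X b a → a ≡ b

  <-trans : ∀ {a b c} → _<_ X a b → _<_ X b c → _<_ X a c
  <-trans (a≤b , _) (b≤c , b≢c) = ≤-trans a≤b b≤c , λ { refl → b≢c (≤-antisym b≤c a≤b) }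

open OrderLaws

module _ {A : Set} {P Q : Pred A 0ℓ} (p? : ∀ a → Dec (P a)) (q? : ∀ a → Dec (Q a)) (P⇒Q : ∀ a → P a → Q a) where

  count-mono : (l : List A) → length (filter p? l) ℕ.≤ length (filter q? l)
  count-mono []      = z≤n
  count-mono (a ∷ l) with p? a | q? a
  ... | yes pa | yes _  = s≤s (count-mono l)
  ... | yes pa | no ¬qa = ⊥-elim (¬qa (P⇒Q a pa))
  ... | no _   | yes _  = ℕP.m≤n⇒m≤1+n (count-mono l)
  ... | no _   | no _   = count-mono l

  count-strict : (l : List A) (b : A) → b ∈ l → Q b → ¬ P b → length (filter p? l) ℕ.< length (filter q? l)
  count-strict (a ∷ l) b (here refl) qb ¬pb with p? a | q? a
  ... | yes pa | _      = ⊥-elim (¬pb pa)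
  ... | no _   | yes _  = s≤s (count-mono l)
  ... | no _   | no ¬qb = ⊥-elim (¬qb qb)
  count-strict (a ∷ l) b (there b∈l) qb ¬pb with p? a | q? a
  ... | yes pa | yes _  = s≤s (count-strict l b b∈l qb ¬pb)
  ... | yes pa | no ¬qa = ⊥-elim (¬qa (P⇒Q a pa))
  ... | no _   | yes _  = ℕP.m≤n⇒m≤1+n (count-strict l b b∈l qb ¬pb)
  ... | no _   | no _   = count-strict l b b∈l qb ¬pb

count-< : {A : Set} {P : Pred A 0ℓ} (p? : ∀ a → Dec (P a)) (l : List A) (b : A) → b ∈ l → ¬ P b →
  length (filter p? l) ℕ.< length l
count-< p? (a ∷ l) b (here refl) ¬pb with p? a
... | yes pa = ⊥-elim (¬pb pa)
... | no _   = s≤s (ListP.length-filter p? l)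
count-< p? (a ∷ l) b (there b∈l) ¬pb with p? a
... | yes _ = s≤s (count-< p? l b b∈l ¬pb)
... | no _  = ℕP.m≤n⇒m≤1+n (count-< p? l b b∈l ¬pb)

-- depth y = #{w : w < y}; it strictly increases along <, giving well-founded induction.
module _ {X : FinPoset} (laws : OrderLaws X) where

  depth : Carrier X → ℕ
  depth y = length (filter (λ w → _<?_ X w y) (elems X))

  depth-< : ∀ {z y} → z ∈ elems X → _<_ X z y → depth z ℕ.< depth y
  depth-< {z} {y} z∈X z<y =
    count-strict (λ w → _<?_ X w z) (λ w → _<?_ X w y) (λ w w<z → <-trans laws w<z z<y) (elems X) z z∈X z<y
      (λ (_ , z≢z) → z≢z refl)

  depth-bound : ∀ {y} → y ∈ elems X → depth y ℕ.< length (elems X)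
  depth-bound {y} y∈X = count-< (λ w → _<?_ X w y) (elems X) y y∈X (λ (_ , y≢y) → y≢y refl)

-- The fuel-driven definition of the Möbius function satisfies the defining recursion:
-- the depth of the argument decreases along the recursion and stays below  #elems,
-- so the fuel  #elems  supplied by  mobius  is always sufficient.
module MobiusRecursion (X : FinPoset) (laws : OrderLaws X) (x : Carrier X) where

  in-[x,_⟩? : (y z : Carrier X) → Dec ((_≤_ X x z) × (_<_ X z y))
  in-[x, y ⟩? z = _≤?_ X x z ×-dec _<?_ X z y

  private
    fuel-irrelevant : ∀ f f′ y → depth laws y ℕ.< f → depth laws y ℕ.< f′ → mobiusFuel X f x y ≡ mobiusFuel X f′ x y
    fuel-irrelevant (suc f) (suc f′) y hf hf′ with _≟_ X x y
    ... | yes _ = refl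
    ... | no _ with _≤?_ X x y
    ...   | no _  = refl
    ...   | yes _ = cong -_ (∑-cong (filter in-[x, y ⟩? (elems X)) λ z z∈ →
            let z∈X , _ , z<y = ∈-filter⁻ in-[x, y ⟩? {xs = elems X} z∈
                dz<dy = depth-< laws z∈X z<y
            in fuel-irrelevant f f′ z (ℕP.<-≤-trans dz<dy (ℕP.≤-pred hf)) (ℕP.<-≤-trans dz<dy (ℕP.≤-pred hf′)))

  μ : Carrier X → ℤ
  μ = mobius X x

  μ-refl : x ∈ elems X → μ x ≡ + 1
  μ-refl x∈X with length (elems X) | depth-bound laws x∈X
  ... | suc f | _ with _≟_ X x x
  ...   | yes _   = refl
  ...   | no x≢x = ⊥-elim (x≢x refl)

  μ-rec : ∀ {y} → y ∈ elems X → ¬ x ≡ y → _≤_ X x y → μ y ≡ - ∑ (elems X) (λ z → ind (in-[x, y ⟩? z) (μ z))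
  μ-rec {y} y∈X x≢y x≤y = trans (unfold (length (elems X)) (depth-bound laws y∈X))
                                 (cong -_ (∑-filter in-[x, y ⟩? (elems X) μ))
    where
    unfold : ∀ f → depth laws y ℕ.< f → mobiusFuel X f x y ≡ - ∑ (filter in-[x, y ⟩? (elems X)) μ
    unfold (suc f) hf with _≟_ X x y
    ... | yes x≡y = ⊥-elim (x≢y x≡y)
    ... | no _ with _≤?_ X x y
    ...   | no x≰y = ⊥-elim (x≰y x≤y)
    ...   | yes _  = cong -_ (∑-cong (filter in-[x, y ⟩? (elems X)) λ z z∈ →
            let z∈X , _ , z<y = ∈-filter⁻ in-[x, y ⟩? {xs = elems X} z∈
            in fuel-irrelevant f (length (elems X)) z (ℕP.<-≤-trans (depth-< laws z∈X z<y) (ℕP.≤-pred hf))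
                               (depth-bound laws z∈X))

dual-laws : (X : FinPoset) → OrderLaws X → OrderLaws (dual X)
dual-laws X laws = record
  { ≤-trans   = λ a≥b b≥c → ≤-trans laws b≥c a≥b
  ; ≤-antisym = λ a≥b b≥a → ≤-antisym laws b≥a a≥b }

sub-laws : (X : FinPoset) {S : Pred (Carrier X) 0ℓ} (S? : ∀ x → Dec (S x)) → OrderLaws X → OrderLaws (sub X S?)
sub-laws X S? laws = record { ≤-trans = ≤-trans laws ; ≤-antisym = ≤-antisym laws }

chain-laws : (n : ℕ) → OrderLaws (chain n)
chain-laws n = record { ≤-trans = FinP.≤-trans ; ≤-antisym = FinP.≤-antisym }

tree-laws : (t n : ℕ) → OrderLaws (tree t n)
tree-laws t n = record
  { ≤-trans   = prefix-trans trans
  ; ≤-antisym = λ u⊑w w⊑u → Pointwise-≡⇒≡ (prefix-antisym (λ a≡b _ → a≡b) u⊑w w⊑u) }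

rees-laws : (X : FinPoset) (rX : Carrier X → ℕ) (Y : FinPoset) (rY : Carrier Y → ℕ) →
  OrderLaws X → OrderLaws Y → OrderLaws (rees X rX Y rY)
rees-laws X rX Y rY lawsX lawsY = record
  { ≤-trans = λ { {x₁ , y₁} {x₂ , y₂} {x₃ , y₃} (x₁≤x₂ , y₁≤y₂ , gap₁₂) (x₂≤x₃ , y₂≤y₃ , gap₂₃) →
      ≤-trans lawsX x₁≤x₂ x₂≤x₃ , ≤-trans lawsY y₁≤y₂ y₂≤y₃ ,
      gap-trans (+ rY y₁) (+ rY y₂) (+ rY y₃) (+ rX x₁) (+ rX x₂) (+ rX x₃) gap₁₂ gap₂₃ }
  ; ≤-antisym = λ { (x₁≤x₂ , y₁≤y₂ , _) (x₂≤x₁ , y₂≤y₁ , _) →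
      cong₂ _,_ (≤-antisym lawsX x₁≤x₂ x₂≤x₁) (≤-antisym lawsY y₁≤y₂ y₂≤y₁) } }
  where
  gap-trans : ∀ a₁ a₂ a₃ b₁ b₂ b₃ → (a₂ - a₁) ℤ.≤ (b₂ - b₁) → (a₃ - a₂) ℤ.≤ (b₃ - b₂) →
              (a₃ - a₁) ℤ.≤ (b₃ - b₁)
  gap-trans a₁ a₂ a₃ b₁ b₂ b₃ p q =
    subst₂ ℤ._≤_ (ℤP.+-minus-telescope a₃ a₂ a₁) (ℤP.+-minus-telescope b₃ b₂ b₁) (ℤP.+-mono-≤ q p)

plus-laws : (X : FinPoset) → OrderLaws X → OrderLaws (plus X)
plus-laws X laws = record { ≤-trans = trans′ ; ≤-antisym = antisym′ }
  where
  trans′ : ∀ {a b c} → PlusLe (_≤_ X) a b → PlusLe (_≤_ X) b c → PlusLe (_≤_ X) a c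
  trans′ {c = nothing} _ _ = ≤new
  trans′ (old≤old a≤b) (old≤old b≤c) = old≤old (≤-trans laws a≤b b≤c)
  antisym′ : ∀ {a b} → PlusLe (_≤_ X) a b → PlusLe (_≤_ X) b a → a ≡ b
  antisym′ {nothing} {nothing} _ _ = refl
  antisym′ (old≤old a≤b) (old≤old b≤a) = cong just (≤-antisym laws a≤b b≤a)

hat-laws : (X : FinPoset) → OrderLaws X → OrderLaws (hat X)
hat-laws X laws = record { ≤-trans = trans′ ; ≤-antisym = antisym′ }
  where
  trans′ : ∀ {a b c} → HatLe (_≤_ X) a b → HatLe (_≤_ X) b c → HatLe (_≤_ X) a c
  trans′ bot≤ _ = bot≤
  trans′ _ ≤top = ≤top
  trans′ (inj≤inj a≤b) (inj≤inj b≤c) = inj≤inj (≤-trans laws a≤b b≤c)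
  antisym′ : ∀ {a b} → HatLe (_≤_ X) a b → HatLe (_≤_ X) b a → a ≡ b
  antisym′ bot≤ bot≤ = refl
  antisym′ ≤top ≤top = refl
  antisym′ (inj≤inj a≤b) (inj≤inj b≤a) = cong inj (≤-antisym laws a≤b b≤a)

module HatBottom (X : FinPoset) (laws : OrderLaws X) where

  private
    open module M = MobiusRecursion (hat X) (hat-laws X laws) bot

    ∑-hat : (f : Carrier (hat X) → ℤ) → ∑ (elems (hat X)) f ≡ f bot ℤ.+ (f top ℤ.+ ∑ (elems X) (λ z → f (inj z)))
    ∑-hat f = cong (λ s → f bot ℤ.+ (f top ℤ.+ s)) (∑-map inj (elems X) f)

    -- Away from the new minimum, the recursion at y sees the minimum (contributing 1) and the old
    -- points; the new maximum contributes when it lies below y, which never happens for y ≠ top.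
    rec-at : ∀ {y} → y ∈ elems (hat X) → ¬ y ≡ bot → ¬ _<_ (hat X) top y →
      μ y ≡ - (+ 1 ℤ.+ ∑ (elems X) (λ z → ind (in-[x, y ⟩? (inj z)) (μ (inj z))))
    rec-at {y} y∈X̂ y≢bot top≮y = trans (μ-rec y∈X̂ (λ bot≡y → y≢bot (sym bot≡y)) bot≤)
      (cong -_ (trans (∑-hat (λ w → ind (in-[x, y ⟩? w) (μ w))) (cong₂ ℤ._+_
        (trans (ind-yes (in-[x, y ⟩? bot) (bot≤ , bot≤ , λ bot≡y → y≢bot (sym bot≡y))) (μ-refl (here refl)))
        (drop-zeroˡ _ (ind-no (in-[x, y ⟩? top) (λ (_ , top<y) → top≮y top<y))))))

  μ̂ : Carrier X → ℤ
  μ̂ z = mobius (hat X) bot (inj z)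

  μ̂-rec : ∀ {z} → z ∈ elems X → μ̂ z ≡ - (+ 1 ℤ.+ ∑ (elems X) (λ z′ → ind (_<?_ X z′ z) (μ̂ z′)))
  μ̂-rec {z} z∈X = trans (rec-at (there (there (∈-map⁺ inj z∈X))) (λ ()) (λ { (() , _) }))
    (cong (λ s → - (+ 1 ℤ.+ s)) (∑-cong′ (elems X) (λ z′ → ind-⇔ (in-[x, inj z ⟩? (inj z′)) (_<?_ X z′ z)
      (λ { (_ , inj≤inj z′≤z , z′≢z) → z′≤z , λ { refl → z′≢z refl } })
      (λ (z′≤z , z′≢z) → bot≤ , inj≤inj z′≤z , λ { refl → z′≢z refl }) refl)))

  μhat-≡ : μhat X ≡ - (+ 1 ℤ.+ ∑ (elems X) μ̂)
  μhat-≡ = trans (rec-at (there (here refl)) (λ ()) (λ (_ , top≢top) → top≢top refl))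
    (cong (λ s → - (+ 1 ℤ.+ s)) (∑-cong′ (elems X) (λ z → ind-yes (in-[x, top ⟩? (inj z)) (bot≤ , ≤top , λ ()))))

-- Restricting X to a down-closed subset S does not change  μ̂  on S, since the recursion
-- for  μ̂ z  only involves elements below z.
module _ (X : FinPoset) (laws : OrderLaws X) {S : Pred (Carrier X) 0ℓ} (S? : ∀ x → Dec (S x))
         (S-down : ∀ {a b} → _<_ X a b → S b → S a) where

  private
    module ĤX = HatBottom X laws
    module ĤS = HatBottom (sub X S?) (sub-laws X S? laws)

  μ̂-downset : ∀ {z} → z ∈ elems X → S z → ĤS.μ̂ z ≡ ĤX.μ̂ z
  μ̂-downset {z} z∈X Sz = by-depth (suc (depth laws z)) z z∈X Sz ℕP.≤-refl
    where
    by-depth : ∀ k z → z ∈ elems X → S z → depth laws z ℕ.< k → ĤS.μ̂ z ≡ ĤX.μ̂ z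
    by-depth (suc k) z z∈X Sz dz<k = trans (ĤS.μ̂-rec (∈-filter⁺ S? z∈X Sz)) (trans
      (cong (λ s → - (+ 1 ℤ.+ s)) (trans (∑-filter S? (elems X) _) (∑-cong (elems X) step)))
      (sym (ĤX.μ̂-rec z∈X)))
      where
      step : ∀ z′ → z′ ∈ elems X → ind (S? z′) (ind (_<?_ X z′ z) (ĤS.μ̂ z′)) ≡ ind (_<?_ X z′ z) (ĤX.μ̂ z′)
      step z′ z′∈X with _<?_ X z′ z
      ... | no _ = ind-0 (S? z′)
      ... | yes z′<z = trans (ind-yes (S? z′) (S-down z′<z Sz))
        (by-depth k z′ z′∈X (S-down z′<z Sz) (ℕP.<-≤-trans (depth-< laws z′∈X z′<z) (ℕP.≤-pred dz<k)))

module PlusBottom (X : FinPoset) (laws : OrderLaws X) (m : Carrier X) (m∈X : m ∈ elems X)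
                  (least : ∀ {q} → q ∈ elems X → _≤_ X m q) where

  private
    open module M = MobiusRecursion (plus X) (plus-laws X laws) (just m)

  μ⁺ : Carrier X → ℤ
  μ⁺ q = mobius (plus X) (just m) (just q)

  μ⁺-top : mobius (plus X) (just m) nothing ≡ - ∑ (elems X) μ⁺
  μ⁺-top = trans (μ-rec (here refl) (λ ()) ≤new) (cong -_ (trans
    (drop-zeroˡ _ (ind-no (in-[x, nothing ⟩? nothing) {μ nothing} (λ (_ , _ , new≢new) → new≢new refl)))
    (trans (∑-map just (elems X) _)
      (∑-cong (elems X) (λ q q∈X → ind-yes (in-[x, nothing ⟩? (just q)) (old≤old (least q∈X) , ≤new , λ ()))))))

  μ⁺-rec : ∀ {q} → q ∈ elems X →
    μ⁺ q ≡ ind (_≟_ X q m) (+ 1) ℤ.+ - ∑ (elems X) (λ q′ → ind (_<?_ X q′ q) (μ⁺ q′))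
  μ⁺-rec {q} q∈X with _≟_ X q m
  ... | yes refl = trans (μ-refl (there (∈-map⁺ just m∈X))) (sym (cong (λ s → + 1 ℤ.+ - s)
        (∑-zero (elems X) (λ q′ q′∈X → ind-no (_<?_ X q′ q) (λ (q′≤m , q′≢m) → q′≢m (≤-antisym laws q′≤m (least q′∈X)))))))
  ... | no q≢m = trans (μ-rec (there (∈-map⁺ just q∈X)) (λ { refl → q≢m refl }) (old≤old (least q∈X)))
        (trans (cong -_ (trans
          (drop-zeroˡ _ (ind-no (in-[x, just q ⟩? nothing) {μ nothing} (λ { (_ , () , _) })))
          (trans (∑-map just (elems X) _) (∑-cong (elems X) (λ q′ q′∈X → ind-⇔ (in-[x, just q ⟩? (just q′)) (_<?_ X q′ q)
            (λ { (_ , old≤old q′≤q , q′≢q) → q′≤q , λ { refl → q′≢q refl } })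
            (λ (q′≤q , q′≢q) → old≤old (least q′∈X) , old≤old q′≤q , λ { refl → q′≢q refl }) refl)))))
        (sym (ℤP.+-identityˡ _)))

module Ranks {P : FinPoset} {0̂ 1̂ : Carrier P} {r : Carrier P → ℕ} {n : ℕ}
             (H : IsBoundedRankedFinPoset P 0̂ 1̂ r n) where

  open IsBoundedRankedFinPoset H

  P-laws : OrderLaws P
  P-laws = record { ≤-trans = IsPartialOrder.trans isPartialOrder ; ≤-antisym = IsPartialOrder.antisym isPartialOrder }

  -- Induction on the depth gap: either x ⋖ y, or some w lies strictly between and both
  -- gaps x..w and w..y are smaller.
  rank-strict : ∀ {x y} → _<_ P x y → r x ℕ.< r y
  rank-strict {x} {y} x<y = by-gap (suc (gap x y)) x y x<y ℕP.≤-refl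
    where
    gap : Carrier P → Carrier P → ℕ
    gap x y = depth P-laws y ∸ depth P-laws x
    by-gap : ∀ k x y → _<_ P x y → gap x y ℕ.< k → r x ℕ.< r y
    by-gap (suc k) x y x<y gap<k with any? (λ w → _<?_ P x w ×-dec _<?_ P w y) (elems P)
    ... | no nothing-between =
      ℕP.≤-reflexive (sym (rank-cover x y (x<y , λ w x<w w<y → nothing-between (lose (complete w) (x<w , w<y)))))
    ... | yes something-between =
      let w , w∈P , x<w , w<y = find something-between
          dx<dw = depth-< P-laws (complete x) x<w
          dw<dy = depth-< P-laws w∈P w<y
      in ℕP.<-trans (by-gap k x w x<w (ℕP.<-≤-trans (ℕP.∸-monoˡ-< dw<dy (ℕP.<⇒≤ dx<dw)) (ℕP.≤-pred gap<k)))
                    (by-gap k w y w<y (ℕP.<-≤-trans (ℕP.∸-monoʳ-< dx<dw (ℕP.<⇒≤ dw<dy)) (ℕP.≤-pred gap<k)))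

  rank-mono : ∀ {x y} → _≤_ P x y → r x ℕ.≤ r y
  rank-mono {x} {y} x≤y with _≟_ P x y
  ... | yes refl = ℕP.≤-refl
  ... | no x≢y  = ℕP.<⇒≤ (rank-strict (x≤y , x≢y))

  rank≤n : ∀ x → r x ℕ.≤ n
  rank≤n x = subst (r x ℕ.≤_) length≡n (rank-mono (1̂-max x))

  rank≥1 : ∀ {x} → ¬ x ≡ 0̂ → 1 ℕ.≤ r x
  rank≥1 {x} x≢0̂ = subst (ℕ._< r x) rank-0̂ (rank-strict (0̂-min x , λ 0̂≡x → x≢0̂ (sym 0̂≡x)))

  1̂≢0̂ : 1 ℕ.≤ n → ¬ 1̂ ≡ 0̂
  1̂≢0̂ n≥1 1̂≡0̂ = ℕP.<⇒≢ n≥1 (sym (trans (sym length≡n) (trans (cong r 1̂≡0̂) rank-0̂)))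

module _ {a b c e : ℕ} (e≤c : e ℕ.≤ c) where

  private
    gap-≡ : + c - + e ≡ + (c ∸ e)
    gap-≡ = trans (ℤP.m-n≡m⊖n c e) (ℤP.⊖-≥ e≤c)

    rearrange : + (c ∸ e) ℤ.+ + b ≡ + (b ℕ.+ (c ∸ e))
    rearrange = trans (ℤP.+-comm (+ (c ∸ e)) (+ b)) (sym (ℤP.pos-+ b (c ∸ e)))

  gap⇒ : (+ a - + b) ℤ.≤ (+ c - + e) → a ℕ.≤ b ℕ.+ (c ∸ e)
  gap⇒ p = ℤP.drop‿+≤+ (subst₂ ℤ._≤_ (cancel (+ a) (+ b)) rearrange
                          (ℤP.+-monoˡ-≤ (+ b) (subst ((+ a - + b) ℤ.≤_) gap-≡ p)))
    where
    cancel : ∀ x y → (x - y) ℤ.+ y ≡ x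
    cancel = solve-∀

  gap⇐ : a ℕ.≤ b ℕ.+ (c ∸ e) → (+ a - + b) ℤ.≤ (+ c - + e)
  gap⇐ p = subst ((+ a - + b) ℤ.≤_) (sym gap-≡) (subst (ℤ._≤_ (+ a - + b)) (cancel (+ (c ∸ e)) (+ b))
             (ℤP.+-monoˡ-≤ (- + b) (subst (+ a ℤ.≤_) (sym rearrange) (ℤ.+≤+ p))))
    where
    cancel : ∀ x y → (x ℤ.+ y) - y ≡ x
    cancel = solve-∀

∸-pred-pred : ∀ {a} b → 1 ℕ.≤ a → (b ∸ 1) ∸ (a ∸ 1) ≡ b ∸ a
∸-pred-pred {suc a} b _ = ℕP.∸-+-assoc b 1 a

pred-< : ∀ {a n} → 1 ℕ.≤ a → a ℕ.≤ n → a ∸ 1 ℕ.< n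
pred-< {suc a} _ a<n = a<n

window-fits : ∀ {a b c} → 1 ℕ.≤ a → a ℕ.≤ b → c ℕ.≤ a ∸ 1 → c ℕ.+ (b ∸ a) ℕ.≤ b ∸ 1
window-fits {suc a} {suc b} _ (s≤s a≤b) c≤a =
  ℕP.≤-trans (ℕP.+-monoˡ-≤ (b ∸ a) c≤a) (ℕP.≤-reflexive (ℕP.m+[n∸m]≡n a≤b))

∸-split : ∀ {a b} n → a ℕ.≤ b → b ℕ.≤ n → n ∸ a ≡ (n ∸ b) ℕ.+ (b ∸ a)
∸-split {a} {b} n a≤b b≤n = begin
  n ∸ a                   ≡⟨ cong (_∸ a) (sym (ℕP.m∸n+n≡m b≤n)) ⟩
  ((n ∸ b) ℕ.+ b) ∸ a     ≡⟨ ℕP.+-∸-assoc (n ∸ b) a≤b ⟩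
  (n ∸ b) ℕ.+ (b ∸ a)     ∎
  where open ≡-Reasoning

∸-co-ranks : ∀ {a b} n → a ℕ.≤ b → b ℕ.≤ n → (n ∸ a) ∸ (n ∸ b) ≡ b ∸ a
∸-co-ranks {a} {b} n a≤b b≤n = trans (cong (_∸ (n ∸ b)) (∸-split n a≤b b≤n)) (ℕP.m+n∸m≡n (n ∸ b) (b ∸ a))

∑-window : ∀ a d m (g : ℕ → ℤ) {A : ℕ → Set} (A? : ∀ k → Dec (A k)) →
  (∀ k → A k → a ℕ.≤ k × k ℕ.≤ a ℕ.+ d) → (∀ k → a ℕ.≤ k × k ℕ.≤ a ℕ.+ d → A k) → a ℕ.+ d ℕ.< m →
  ∑ (upTo m) (λ k → ind (A? k) (g k)) ≡ ∑ (upTo (suc d)) (λ e → g (a ℕ.+ e))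
∑-window zero zero (suc m) g A? to from _ =
  trans (∑-upTo-suc m (λ k → ind (A? k) (g k))) (cong₂ ℤ._+_ (ind-yes (A? 0) (from 0 (z≤n , z≤n)))
  (∑-zero (upTo m) (λ k _ → ind-no (A? (suc k)) (λ Ak → ℕP.n≮0 (proj₂ (to (suc k) Ak))))))
∑-window zero (suc d) (suc m) g A? to from (s≤s d<m) =
  trans (∑-upTo-suc m (λ k → ind (A? k) (g k))) (trans (cong₂ ℤ._+_ (ind-yes (A? 0) (from 0 (z≤n , z≤n)))
    (∑-window zero d m (λ k → g (suc k)) (λ k → A? (suc k))
      (λ k Ak → z≤n , ℕP.≤-pred (proj₂ (to (suc k) Ak))) (λ k (_ , k≤d) → from (suc k) (z≤n , s≤s k≤d)) d<m))
    (sym (∑-upTo-suc (suc d) g)))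
∑-window (suc a) d (suc m) g A? to from (s≤s a+d<m) =
  trans (∑-upTo-suc m (λ k → ind (A? k) (g k))) (trans (drop-zeroˡ _ (ind-no (A? 0) (λ A0 → ℕP.n≮0 (proj₁ (to 0 A0)))))
    (∑-window a d m (λ k → g (suc k)) (λ k → A? (suc k))
      (λ k Ak → let a<k , k≤a+d = to (suc k) Ak in ℕP.≤-pred a<k , ℕP.≤-pred k≤a+d)
      (λ k (a≤k , k≤a+d) → from (suc k) (s≤s a≤k , s≤s k≤a+d)) a+d<m))

module Geometric (t : ℕ) where

  S : ℕ → ℤ
  S d = ∑ (upTo (suc d)) (λ e → + (t ^ e))

  pos-^-suc : ∀ k → + (t ^ suc k) ≡ + t ℤ.* + (t ^ k)
  pos-^-suc k = ℤP.pos-* t (t ^ k)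

  S-pred : ∀ {a} → 1 ℕ.≤ a → S a ≡ + 1 ℤ.+ + t ℤ.* S (a ∸ 1)
  S-pred {suc d} _ = trans (∑-upTo-suc (suc d) (λ e → + (t ^ e)))
    (cong (ℤ._+_ (+ 1)) (trans (∑-cong′ (upTo (suc d)) pos-^-suc) (∑-*ˡ (upTo (suc d)) (+ t) (λ e → + (t ^ e)))))

  S-shift : ∀ a d → ∑ (upTo (suc d)) (λ e → + (t ^ (a ℕ.+ e))) ≡ + (t ^ a) ℤ.* S d
  S-shift a d = trans (∑-cong′ (upTo (suc d)) pow-+) (∑-*ˡ (upTo (suc d)) (+ (t ^ a)) (λ e → + (t ^ e)))
    where
    pow-+ : ∀ e → + (t ^ (a ℕ.+ e)) ≡ + (t ^ a) ℤ.* + (t ^ e)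
    pow-+ e = trans (cong +_ (ℕP.^-distribˡ-+-* t a e)) (ℤP.pos-* (t ^ a) (t ^ e))

module TreeCounting (t : ℕ) where

  open Geometric t

  Word : Set
  Word = List (Fin t)

  words : ℕ → List Word
  words = wordsOfLength t

  _⊑?_ : (u w : Word) → Dec (Prefix _≡_ u w)
  _⊑?_ = prefix? FinP._≟_

  private
    snoc : Word → Fin t → Word
    snoc v a = v ++ (a ∷ [])

    length-snoc : ∀ v a → length (snoc v a) ≡ suc (length v)
    length-snoc v a = trans (ListP.length-++ v) (ℕP.+-comm (length v) 1)

    words-length : ∀ k {w} → w ∈ words k → length w ≡ k
    words-length zero    (here refl) = refl
    words-length (suc k) w∈ =
      let v , v∈ , w∈′ = find (∈-concatMap⁻ (λ v → map (snoc v) (allFin t)) {xs = words k} w∈)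
          a , _ , w≡va = ∈-map⁻ (snoc v) w∈′
      in trans (cong length w≡va) (trans (length-snoc v a) (cong suc (words-length k v∈)))

    prefix-refl : ∀ (w : Word) → Prefix _≡_ w w
    prefix-refl w = fromPointwise (≡⇒Pointwise-≡ refl)

    prefix-equal : ∀ {u w : Word} → length u ≡ length w → Prefix _≡_ u w → u ≡ w
    prefix-equal |u|≡|w| u⊑w = Pointwise-≡⇒≡ (toPointwise |u|≡|w| u⊑w)

    prefix-++ : ∀ {u w : Word} v → Prefix _≡_ u w → Prefix _≡_ u (w ++ v)
    prefix-++ v []         = []
    prefix-++ v (eq ∷ u⊑w) = eq ∷ prefix-++ v u⊑w

    prefix-cut : ∀ {u : Word} w v → length u ℕ.≤ length w → Prefix _≡_ u (w ++ v) → Prefix _≡_ u w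
    prefix-cut {[]}    w       v _         _           = []
    prefix-cut {a ∷ u} (b ∷ w) v (s≤s |u|≤) (eq ∷ u⊑wv) = eq ∷ prefix-cut w v |u|≤ u⊑wv

    split-last : ∀ k (u : Word) → length u ≡ suc k → ∃ λ u′ → ∃ λ b → u ≡ snoc u′ b × length u′ ≡ k
    split-last zero    (b ∷ [])    refl = [] , b , refl , refl
    split-last (suc k) (a ∷ u)     eq with split-last k u (ℕP.suc-injective eq)
    ... | u′ , b , refl , |u′| = a ∷ u′ , b , refl , cong suc |u′|

    ∑-allFin-1 : ∑ (allFin t) (λ _ → + 1) ≡ + t
    ∑-allFin-1 = trans (count (allFin t)) (cong +_ (ListP.length-tabulate (λ i → i)))
      where
      count : {A : Set} (l : List A) → ∑ l (λ _ → + 1) ≡ + length l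
      count []      = refl
      count (a ∷ l) = cong (ℤ._+_ (+ 1)) (count l)

    ∑-allFin-δ : (b : Fin t) → ∑ (allFin t) (λ a → ind (a FinP.≟ b) (+ 1)) ≡ + 1
    ∑-allFin-δ b = trans (∑-delta (allFin t) b _ (allFin⁺ t) (∈-allFin b) (λ c _ c≢b → ind-no (c FinP.≟ b) c≢b))
                         (ind-yes (b FinP.≟ b) refl)

    ∑-words-suc : ∀ k (f : Word → ℤ) → ∑ (words (suc k)) f ≡ ∑ (words k) (λ v → ∑ (allFin t) (λ a → f (snoc v a)))
    ∑-words-suc k f = trans (∑-concatMap (λ v → map (snoc v) (allFin t)) (words k) f)
                            (∑-cong′ (words k) (λ v → ∑-map (snoc v) (allFin t) f))

  #ext : ℕ → Word → ℤ
  #ext k u = ∑ (words k) (λ w → ind (u ⊑? w) (+ 1))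

  expected : ℕ → Word → ℤ
  expected k u = ind (length u ℕ.≤? k) (+ (t ^ (k ∸ length u)))

  private
    #ext-snoc : ℕ → Word → ℤ
    #ext-snoc k u = ∑ (words k) (λ v → ∑ (allFin t) (λ a → ind (u ⊑? snoc v a) (+ 1)))

    -- If |u| ≤ k, every letter appended to an extension of u of length k gives one of length k+1.
    extensions-short : ∀ {k u} → (∀ u → #ext k u ≡ expected k u) → length u ℕ.≤ k → #ext-snoc k u ≡ expected (suc k) u
    extensions-short {k} {u} counted |u|≤k = begin
      ∑ (words k) (λ v → ∑ (allFin t) (λ a → ind (u ⊑? snoc v a) (+ 1)))
        ≡⟨ ∑-cong (words k) (λ v v∈ → ∑-cong′ (allFin t) (λ a → ind-⇔ (u ⊑? snoc v a) (u ⊑? v)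
             (prefix-cut v (a ∷ []) (subst (length u ℕ.≤_) (sym (words-length k v∈)) |u|≤k)) (prefix-++ (a ∷ [])) refl)) ⟩
      ∑ (words k) (λ v → ∑ (allFin t) (λ _ → ind (u ⊑? v) (+ 1)))
        ≡⟨ ∑-cong′ (words k) (λ v → trans (∑-ind (u ⊑? v) (allFin t) (λ _ → + 1))
             (trans (cong (ind (u ⊑? v)) (trans ∑-allFin-1 (sym (ℤP.*-identityʳ (+ t))))) (ind-*ˡ (u ⊑? v) (+ t) (+ 1)))) ⟩
      ∑ (words k) (λ v → + t ℤ.* ind (u ⊑? v) (+ 1))
        ≡⟨ ∑-*ˡ (words k) (+ t) _ ⟩
      + t ℤ.* #ext k u
        ≡⟨ cong (+ t ℤ.*_) (trans (counted u) (ind-yes (length u ℕ.≤? k) |u|≤k)) ⟩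
      + t ℤ.* + (t ^ (k ∸ length u))
        ≡⟨ sym (pos-^-suc (k ∸ length u)) ⟩
      + (t ^ suc (k ∸ length u))
        ≡⟨ cong (λ e → + (t ^ e)) (sym (ℕP.+-∸-assoc 1 |u|≤k)) ⟩
      + (t ^ (suc k ∸ length u))
        ≡⟨ sym (ind-yes (length u ℕ.≤? suc k) (ℕP.m≤n⇒m≤1+n |u|≤k)) ⟩
      expected (suc k) u ∎
      where open ≡-Reasoning

    -- If |u′| = k, the extensions of u′b of length k+1 are v b with v an extension of u′ of length k,
    -- i.e. v = u′: there is exactly one.
    extensions-exact : ∀ {k} u′ b → (∀ u → #ext k u ≡ expected k u) → length u′ ≡ k →
      #ext-snoc k (snoc u′ b) ≡ expected (suc k) (snoc u′ b)
    extensions-exact {k} u′ b counted |u′|≡k = begin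
      ∑ (words k) (λ v → ∑ (allFin t) (λ a → ind (snoc u′ b ⊑? snoc v a) (+ 1)))
        ≡⟨ ∑-cong (words k) (λ v v∈ → ∑-cong′ (allFin t) (λ a →
             trans (ind-⇔ (snoc u′ b ⊑? snoc v a) ((u′ ⊑? v) ×-dec (a FinP.≟ b)) (split v∈) (join v∈) refl)
                   (ind-× (u′ ⊑? v) (a FinP.≟ b) (+ 1)))) ⟩
      ∑ (words k) (λ v → ∑ (allFin t) (λ a → ind (u′ ⊑? v) (ind (a FinP.≟ b) (+ 1))))
        ≡⟨ ∑-cong′ (words k) (λ v → trans (∑-ind (u′ ⊑? v) (allFin t) _) (cong (ind (u′ ⊑? v)) (∑-allFin-δ b))) ⟩
      #ext k u′
        ≡⟨ trans (counted u′) (ind-yes (length u′ ℕ.≤? k) (ℕP.≤-reflexive |u′|≡k)) ⟩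
      + (t ^ (k ∸ length u′))
        ≡⟨ cong (λ e → + (t ^ e)) (trans (cong (k ∸_) |u′|≡k) (trans (ℕP.n∸n≡0 k)
             (sym (trans (cong (suc k ∸_) |u|≡k+1) (ℕP.n∸n≡0 (suc k)))))) ⟩
      + (t ^ (suc k ∸ length (snoc u′ b)))
        ≡⟨ sym (ind-yes (length (snoc u′ b) ℕ.≤? suc k) (ℕP.≤-reflexive |u|≡k+1)) ⟩
      expected (suc k) (snoc u′ b) ∎
      where
      open ≡-Reasoning
      |u|≡k+1 : length (snoc u′ b) ≡ suc k
      |u|≡k+1 = trans (length-snoc u′ b) (cong suc |u′|≡k)
      split : ∀ {v} → v ∈ words k → ∀ {a} → Prefix _≡_ (snoc u′ b) (snoc v a) → Prefix _≡_ u′ v × a ≡ b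
      split {v} v∈ {a} u′b⊑va =
        let u′≡v , b≡a = ListP.∷ʳ-injective u′ v (prefix-equal
              (trans |u|≡k+1 (sym (trans (length-snoc v a) (cong suc (words-length k v∈))))) u′b⊑va)
        in subst (Prefix _≡_ u′) u′≡v (prefix-refl u′) , sym b≡a
      join : ∀ {v} → v ∈ words k → ∀ {a} → Prefix _≡_ u′ v × a ≡ b → Prefix _≡_ (snoc u′ b) (snoc v a)
      join {v} v∈ (u′⊑v , refl) = subst (λ w → Prefix _≡_ (snoc u′ b) (snoc w b))
        (prefix-equal (trans |u′|≡k (sym (words-length k v∈))) u′⊑v) (prefix-refl (snoc u′ b))

    extensions-long : ∀ {k u} → ¬ length u ℕ.≤ suc k → #ext-snoc k u ≡ expected (suc k) u
    extensions-long {k} {u} too-long = trans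
      (∑-cong (words k) (λ v v∈ → ∑-zero (allFin t) (λ a _ → ind-no (u ⊑? snoc v a) (λ u⊑va →
        too-long (ℕP.≤-trans (length-mono u⊑va) (ℕP.≤-reflexive (trans (length-snoc v a) (cong suc (words-length k v∈)))))))))
      (trans (∑-zero (words k) (λ _ _ → refl)) (sym (ind-no (length u ℕ.≤? suc k) too-long)))

  extensions : ∀ k u → #ext k u ≡ expected k u
  extensions zero    []      = refl
  extensions zero    (a ∷ u) = refl
  extensions (suc k) u = trans (∑-words-suc k _) (by-length (length u ℕ.≤? k) (length u ℕ.≟ suc k))
    where
    by-length : Dec (length u ℕ.≤ k) → Dec (length u ≡ suc k) → #ext-snoc k u ≡ expected (suc k) u
    by-length (yes |u|≤k) _ = extensions-short (extensions k) |u|≤k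
    by-length (no |u|≰k) (no |u|≢k+1) = extensions-long too-long
      where
      too-long : ¬ length u ℕ.≤ suc k
      too-long |u|≤k+1 with ℕP.m≤n⇒m<n∨m≡n |u|≤k+1
      ... | inj₁ |u|<k+1 = |u|≰k (ℕP.≤-pred |u|<k+1)
      ... | inj₂ |u|≡k+1 = |u|≢k+1 |u|≡k+1
    by-length (no _) (yes |u|≡k+1) with split-last k u |u|≡k+1
    ... | u′ , b , refl , |u′|≡k = extensions-exact u′ b (extensions k) |u′|≡k

  within : ∀ n u d → length u ℕ.+ d ℕ.≤ n → {A : Word → Set} (A? : ∀ w → Dec (A w)) →
    (∀ w → A w → Prefix _≡_ u w × length w ℕ.≤ length u ℕ.+ d) →
    (∀ w → Prefix _≡_ u w × length w ℕ.≤ length u ℕ.+ d → A w) →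
    ∑ (elems (tree t n)) (λ w → ind (A? w) (+ 1)) ≡ S d
  within n u d |u|+d≤n A? to from = begin
    ∑ (elems (tree t n)) (λ w → ind (A? w) (+ 1))
      ≡⟨ ∑-concatMap words (upTo (suc n)) (λ w → ind (A? w) (+ 1)) ⟩
    ∑ (upTo (suc n)) (λ k → ∑ (words k) (λ w → ind (A? w) (+ 1)))
      ≡⟨ ∑-cong′ (upTo (suc n)) level ⟩
    ∑ (upTo (suc n)) (λ k → ind (k ℕ.≤? length u ℕ.+ d) (ind (length u ℕ.≤? k) (+ (t ^ (k ∸ length u)))))
      ≡⟨ ∑-cong′ (upTo (suc n)) (λ k → sym (ind-× (k ℕ.≤? length u ℕ.+ d) (length u ℕ.≤? k) _)) ⟩
    ∑ (upTo (suc n)) (λ k → ind ((k ℕ.≤? length u ℕ.+ d) ×-dec (length u ℕ.≤? k)) (+ (t ^ (k ∸ length u))))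
      ≡⟨ ∑-window (length u) d (suc n) (λ k → + (t ^ (k ∸ length u))) (λ k → (k ℕ.≤? length u ℕ.+ d) ×-dec (length u ℕ.≤? k))
           (λ k (k≤ , |u|≤k) → |u|≤k , k≤) (λ k (|u|≤k , k≤) → k≤ , |u|≤k) (s≤s |u|+d≤n) ⟩
    ∑ (upTo (suc d)) (λ e → + (t ^ (length u ℕ.+ e ∸ length u)))
      ≡⟨ ∑-cong′ (upTo (suc d)) (λ e → cong (λ k → + (t ^ k)) (ℕP.m+n∸m≡n (length u) e)) ⟩
    S d ∎
    where
    open ≡-Reasoning
    level : ∀ k → ∑ (words k) (λ w → ind (A? w) (+ 1))
                  ≡ ind (k ℕ.≤? length u ℕ.+ d) (ind (length u ℕ.≤? k) (+ (t ^ (k ∸ length u))))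
    level k = trans (∑-cong (words k) (λ w w∈ → trans
        (ind-⇔ (A? w) ((k ℕ.≤? length u ℕ.+ d) ×-dec (u ⊑? w))
          (λ Aw → let u⊑w , |w|≤ = to w Aw in subst (ℕ._≤ length u ℕ.+ d) (words-length k w∈) |w|≤ , u⊑w)
          (λ (k≤ , u⊑w) → from w (u⊑w , subst (ℕ._≤ length u ℕ.+ d) (sym (words-length k w∈)) k≤)) refl)
        (ind-× (k ℕ.≤? length u ℕ.+ d) (u ⊑? w) (+ 1))))
      (trans (∑-ind (k ℕ.≤? length u ℕ.+ d) (words k) _) (cong (ind (k ℕ.≤? length u ℕ.+ d)) (extensions k u)))

toℕ≤n∸1 : ∀ {n} (i : Fin n) → toℕ i ℕ.≤ n ∸ 1
toℕ≤n∸1 {n} i = subst (toℕ i ℕ.≤_) (ℕP.pred[m∸n]≡m∸[1+n] n 0) (FinP.toℕ≤pred[n] i)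

module LeftHandSide {P : FinPoset} {0̂ 1̂ : Carrier P} {r : Carrier P → ℕ} {n : ℕ} (t : ℕ)
               (H : IsBoundedRankedFinPoset P 0̂ 1̂ r n) where

  open IsBoundedRankedFinPoset H
  open Ranks H public
  open Geometric t public

  κ : Carrier P → Carrier P → ℤ
  κ x y = ind (_<?_ P x y) (S (r y ∸ r x))

  P⁻ : List (Carrier P)
  P⁻ = elems (Pminus P 0̂ 1̂ r n)

  PC : FinPoset
  PC = PminusC P 0̂ 1̂ r n

  PC-laws : OrderLaws PC
  PC-laws = rees-laws _ _ (chain n) toℕ (sub-laws P _ P-laws) (chain-laws n)

  P⁻-member : ∀ {y} → y ∈ P⁻ → ¬ y ≡ 0̂
  P⁻-member y∈P⁻ = proj₂ (∈-filter⁻ (λ x → ¬? (_≟_ P x 0̂)) {xs = elems P} y∈P⁻)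

  PC-member : ∀ {y i} → y ∈ P⁻ → toℕ i ℕ.≤ r y ∸ 1 → (y , i) ∈ elems PC
  PC-member {y} {i} y∈P⁻ i≤ =
    ∈-filter⁺ (λ p → toℕ (proj₂ p) ℕ.≤? (r (proj₁ p) ∸ 1)) (∈-cartesianProduct⁺ y∈P⁻ (∈-allFin i)) i≤

  ∑-PC : (f : Carrier PC → ℤ) →
    ∑ (elems PC) f ≡ ∑ P⁻ (λ y → ∑ (allFin n) (λ i → ind (toℕ i ℕ.≤? r y ∸ 1) (f (y , i))))
  ∑-PC f = trans (∑-filter _ (cartesianProduct P⁻ (allFin n)) f) (∑-cartesianProduct P⁻ (allFin n) _)

  -- The rank condition of  P⁻ ∗ C_n  (the shifted rank r - 1 of P⁻ does not change rank differences).
  PC-gap⇒ : ∀ {x y h i} → ¬ x ≡ 0̂ → _≤_ PC (x , h) (y , i) → toℕ i ℕ.≤ toℕ h ℕ.+ (r y ∸ r x)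
  PC-gap⇒ {x} {y} {h} {i} x≢0̂ (x≤y , _ , gap) =
    subst (λ d → toℕ i ℕ.≤ toℕ h ℕ.+ d) (∸-pred-pred (r y) (rank≥1 x≢0̂))
      (gap⇒ (ℕP.∸-monoˡ-≤ 1 (rank-mono x≤y)) gap)

  PC-gap⇐ : ∀ {x y h i} → ¬ x ≡ 0̂ → _≤_ P x y → toℕ h ℕ.≤ toℕ i → toℕ i ℕ.≤ toℕ h ℕ.+ (r y ∸ r x) →
            _≤_ PC (x , h) (y , i)
  PC-gap⇐ {x} {y} {h} {i} x≢0̂ x≤y h≤i i≤ =
    x≤y , h≤i , gap⇐ (ℕP.∸-monoˡ-≤ 1 (rank-mono x≤y))
                     (subst (λ d → toℕ i ℕ.≤ toℕ h ℕ.+ d) (sym (∸-pred-pred (r y) (rank≥1 x≢0̂))) i≤)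

  level-of-1̂ : (j : Fin n) → toℕ j ℕ.≤ r 1̂ ∸ 1
  level-of-1̂ j = subst (λ m → toℕ j ℕ.≤ m ∸ 1) (sym length≡n) (toℕ≤n∸1 j)

  module ĤPC = HatBottom PC PC-laws
  b : Carrier PC → ℤ
  b = ĤPC.μ̂

  -- I_j is the part of P⁻ ∗ C_n below (1̂, j), so  μ(Î_j) = μ_{P⁻∗C_n ∪ 0̂}(0̂, (1̂, j)).
  μhat-I : (j : Fin n) → ¬ 1̂ ≡ 0̂ → μhat (I P 0̂ 1̂ r n j) ≡ b (1̂ , j)
  μhat-I j 1̂≢0̂ = begin
    μhat (I P 0̂ 1̂ r n j)
      ≡⟨ HatBottom.μhat-≡ (I P 0̂ 1̂ r n j) (sub-laws PC below? PC-laws) ⟩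
    - (+ 1 ℤ.+ ∑ (filter below? (elems PC)) (HatBottom.μ̂ (I P 0̂ 1̂ r n j) (sub-laws PC below? PC-laws)))
      ≡⟨ cong (λ s → - (+ 1 ℤ.+ s)) (trans (∑-filter below? (elems PC) _) (∑-cong (elems PC) (λ z z∈PC →
           ind-congʳ (below? z) (μ̂-downset PC PC-laws below? (λ z′<z z<top → <-trans PC-laws z′<z z<top) z∈PC)))) ⟩
    - (+ 1 ℤ.+ ∑ (elems PC) (λ z → ind (below? z) (b z)))
      ≡⟨ sym (ĤPC.μ̂-rec (PC-member 1̂∈P⁻ (level-of-1̂ j))) ⟩
    b (1̂ , j) ∎
    where
    open ≡-Reasoning
    below? : ∀ z → Dec (_<_ PC z (1̂ , j))
    below? z = _<?_ PC z (1̂ , j)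
    1̂∈P⁻ : 1̂ ∈ P⁻
    1̂∈P⁻ = ∈-filter⁺ (λ x → ¬? (_≟_ P x 0̂)) (complete 1̂) 1̂≢0̂

  D : Carrier P → ℤ
  D y = ∑ (allFin n) (λ i → ind (toℕ i ℕ.≤? r y ∸ 1) (+ (t ^ toℕ i) ℤ.* b (y , i)))

  ∑-levels : ∀ {y} → ¬ y ≡ 0̂ → ∑ (allFin n) (λ i → ind (toℕ i ℕ.≤? r y ∸ 1) (+ (t ^ toℕ i))) ≡ S (r y ∸ 1)
  ∑-levels {y} y≢0̂ = trans (∑-allFin n (λ k → ind (k ℕ.≤? r y ∸ 1) (+ (t ^ k))))
    (∑-window 0 (r y ∸ 1) n (λ k → + (t ^ k)) (λ k → k ℕ.≤? r y ∸ 1) (λ k k≤ → z≤n , k≤) (λ k (_ , k≤) → k≤)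
      (pred-< (rank≥1 y≢0̂) (rank≤n y)))

  -- The elements (y, i) above (x, h) form a window of levels  h ≤ i ≤ h + (r y - r x):
  --   Σ_{i ≤ r y - 1, (x,h) < (y,i)} t^i = [x < y] · S(r y - r x) · t^h.
  chain-count : ∀ {x y} → ¬ x ≡ 0̂ → ¬ y ≡ 0̂ → (h : Fin n) → toℕ h ℕ.≤ r x ∸ 1 →
    ∑ (allFin n) (λ i → ind (toℕ i ℕ.≤? r y ∸ 1) (ind (_<?_ PC (x , h) (y , i)) (+ (t ^ toℕ i))))
    ≡ κ x y ℤ.* + (t ^ toℕ h)
  chain-count {x} {y} x≢0̂ y≢0̂ h h≤ = count (_<?_ P x y)
    where
    above? : (i : Fin n) → Dec (toℕ i ℕ.≤ r y ∸ 1 × _<_ PC (x , h) (y , i))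
    above? i = (toℕ i ℕ.≤? r y ∸ 1) ×-dec (_<?_ PC (x , h) (y , i))
    count : (x<?y : Dec (_<_ P x y)) →
      ∑ (allFin n) (λ i → ind (toℕ i ℕ.≤? r y ∸ 1) (ind (_<?_ PC (x , h) (y , i)) (+ (t ^ toℕ i))))
      ≡ ind x<?y (S (r y ∸ r x)) ℤ.* + (t ^ toℕ h)
    count (no x≮y) = ∑-zero (allFin n) (λ i _ → trans (sym (ind-× (toℕ i ℕ.≤? r y ∸ 1) (_<?_ PC (x , h) (y , i)) _))
      (ind-no (above? i) (λ (_ , xh<yi) → not-above i xh<yi)))
      where
      not-above : ∀ i → ¬ _<_ PC (x , h) (y , i)
      not-above i (xh≤yi@(x≤y , h≤i , _) , xh≢yi) with _≟_ P x y
      ... | no x≢y = x≮y (x≤y , x≢y)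
      ... | yes refl = xh≢yi (cong (x ,_) (FinP.toℕ-injective (ℕP.≤-antisym h≤i
            (subst (toℕ i ℕ.≤_) (trans (cong (toℕ h ℕ.+_) (ℕP.n∸n≡0 (r x))) (ℕP.+-identityʳ (toℕ h))) (PC-gap⇒ x≢0̂ xh≤yi)))))
    count (yes x<y@(x≤y , x≢y)) = begin
      ∑ (allFin n) (λ i → ind (toℕ i ℕ.≤? r y ∸ 1) (ind (_<?_ PC (x , h) (y , i)) (+ (t ^ toℕ i))))
        ≡⟨ ∑-cong′ (allFin n) (λ i → trans (sym (ind-× (toℕ i ℕ.≤? r y ∸ 1) (_<?_ PC (x , h) (y , i)) _))
             (ind-⇔ (above? i) (in-window? (toℕ i))
               (λ (_ , xh≤yi , _) → proj₁ (proj₂ xh≤yi) , PC-gap⇒ x≢0̂ xh≤yi)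
               (λ (h≤i , i≤) → ℕP.≤-trans i≤ fits , PC-gap⇐ x≢0̂ x≤y h≤i i≤ , λ xh≡yi → x≢y (cong proj₁ xh≡yi)) refl)) ⟩
      ∑ (allFin n) (λ i → ind (in-window? (toℕ i)) (+ (t ^ toℕ i)))
        ≡⟨ ∑-allFin n (λ k → ind (in-window? k) (+ (t ^ k))) ⟩
      ∑ (upTo n) (λ k → ind (in-window? k) (+ (t ^ k)))
        ≡⟨ ∑-window (toℕ h) d n (λ k → + (t ^ k)) in-window? (λ _ w → w) (λ _ w → w)
             (ℕP.≤-<-trans fits (pred-< (rank≥1 y≢0̂) (rank≤n y))) ⟩
      ∑ (upTo (suc d)) (λ e → + (t ^ (toℕ h ℕ.+ e)))
        ≡⟨ trans (S-shift (toℕ h) d) (ℤP.*-comm (+ (t ^ toℕ h)) (S d)) ⟩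
      S d ℤ.* + (t ^ toℕ h) ∎
      where
      open ≡-Reasoning
      d : ℕ
      d = r y ∸ r x
      in-window? : ∀ k → Dec (toℕ h ℕ.≤ k × k ℕ.≤ toℕ h ℕ.+ d)
      in-window? k = (toℕ h ℕ.≤? k) ×-dec (k ℕ.≤? toℕ h ℕ.+ d)
      fits : toℕ h ℕ.+ d ℕ.≤ r y ∸ 1
      fits = window-fits (rank≥1 x≢0̂) (rank-mono x≤y) h≤

  -- Summing the recursion  μ̂(y,i) = -(1 + Σ_{z < (y,i)} μ̂ z)  over the levels of y, with weights t^i:
  --   D y = -S(r y - 1) - Σ_{x ∈ P⁻} κ x y · D x.
  D-rec : ∀ {y} → y ∈ P⁻ → D y ≡ - S (r y ∸ 1) ℤ.+ - ∑ P⁻ (λ x → κ x y ℤ.* D x)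
  D-rec {y} y∈P⁻ = begin
    D y
      ≡⟨ ∑-cong′ (allFin n) (λ i → ind-congʳ (level? i) (λ i≤ → cong (T i ℤ.*_) (ĤPC.μ̂-rec (PC-member y∈P⁻ i≤)))) ⟩
    ∑ (allFin n) (λ i → ind (level? i) (T i ℤ.* - (+ 1 ℤ.+ ∑ (elems PC) (λ z → ind (below? i z) (b z)))))
      ≡⟨ ∑-cong′ (allFin n) (λ i → expand (level? i) (T i) (below? i)) ⟩
    ∑ (allFin n) (λ i → - ind (level? i) (T i) ℤ.+ - ∑ (elems PC) (λ z → ind (level? i) (ind (below? i z) (T i)) ℤ.* b z))
      ≡⟨ ∑-neg-+ (allFin n) _ _ ⟩
    - ∑ (allFin n) (λ i → ind (level? i) (T i))
      ℤ.+ - ∑ (allFin n) (λ i → ∑ (elems PC) (λ z → ind (level? i) (ind (below? i z) (T i)) ℤ.* b z))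
      ≡⟨ cong₂ (λ u v → - u ℤ.+ - v) (∑-levels y≢0̂)
           (trans (∑-swap (allFin n) (elems PC) _) (∑-cong′ (elems PC) (λ z → ∑-*ʳ (allFin n) _ (b z)))) ⟩
    - S (r y ∸ 1) ℤ.+ - ∑ (elems PC) (λ z → weight z ℤ.* b z)
      ≡⟨ cong (λ v → - S (r y ∸ 1) ℤ.+ - v) (trans (∑-PC _) (∑-cong P⁻ (λ x x∈P⁻ → per-element (P⁻-member x∈P⁻)))) ⟩
    - S (r y ∸ 1) ℤ.+ - ∑ P⁻ (λ x → κ x y ℤ.* D x) ∎
    where
    open ≡-Reasoning
    y≢0̂ : ¬ y ≡ 0̂
    y≢0̂ = P⁻-member y∈P⁻
    T : Fin n → ℤ
    T i = + (t ^ toℕ i)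
    level? : (i : Fin n) → Dec (toℕ i ℕ.≤ r y ∸ 1)
    level? i = toℕ i ℕ.≤? r y ∸ 1
    below? : (i : Fin n) (z : Carrier PC) → Dec (_<_ PC z (y , i))
    below? i z = _<?_ PC z (y , i)
    weight : Carrier PC → ℤ
    weight z = ∑ (allFin n) (λ i → ind (level? i) (ind (below? i z) (T i)))

    expand : ∀ {A : Set} {B : Carrier PC → Set} (c : Dec A) (w : ℤ) (B? : ∀ z → Dec (B z)) →
      ind c (w ℤ.* - (+ 1 ℤ.+ ∑ (elems PC) (λ z → ind (B? z) (b z))))
      ≡ - ind c w ℤ.+ - ∑ (elems PC) (λ z → ind c (ind (B? z) w) ℤ.* b z)
    expand (no _)  w B? = sym (trans (ℤP.+-identityˡ _) (cong -_ (∑-zero (elems PC) (λ _ _ → refl))))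
    expand (yes _) w B? = trans (distrib w _) (cong (λ s → - w ℤ.+ - s)
      (trans (sym (∑-*ˡ (elems PC) w _))
             (∑-cong′ (elems PC) (λ z → trans (sym (ind-*ˡ (B? z) w (b z))) (ind-*ʳ (B? z) w (b z))))))
      where
      distrib : ∀ w s → w ℤ.* - (+ 1 ℤ.+ s) ≡ - w ℤ.+ - (w ℤ.* s)
      distrib = solve-∀

    per-element : ∀ {x} → ¬ x ≡ 0̂ →
      ∑ (allFin n) (λ h → ind (toℕ h ℕ.≤? r x ∸ 1) (weight (x , h) ℤ.* b (x , h))) ≡ κ x y ℤ.* D x
    per-element {x} x≢0̂ = trans (∑-cong′ (allFin n) (λ h → trans
        (ind-congʳ (toℕ h ℕ.≤? r x ∸ 1) (λ h≤ → trans (cong (ℤ._* b (x , h)) (chain-count x≢0̂ y≢0̂ h h≤))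
                                                        (ℤP.*-assoc (κ x y) (T h) (b (x , h)))))
        (ind-*ˡ (toℕ h ℕ.≤? r x ∸ 1) (κ x y) _)))
      (∑-*ˡ (allFin n) (κ x y) _)

  lhs-≡ : ¬ 1̂ ≡ 0̂ → ∑ (allFin n) (λ j → μhat (I P 0̂ 1̂ r n j) ℤ.* + (t ^ suc (toℕ j))) ≡ + t ℤ.* D 1̂
  lhs-≡ 1̂≢0̂ = begin
    ∑ (allFin n) (λ j → μhat (I P 0̂ 1̂ r n j) ℤ.* + (t ^ suc (toℕ j)))
      ≡⟨ ∑-cong′ (allFin n) (λ j → cong₂ ℤ._*_ (μhat-I j 1̂≢0̂) (pos-^-suc (toℕ j))) ⟩
    ∑ (allFin n) (λ j → b (1̂ , j) ℤ.* (+ t ℤ.* + (t ^ toℕ j)))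
      ≡⟨ ∑-cong′ (allFin n) (λ j → trans (rearrange (b (1̂ , j)) (+ t) (+ (t ^ toℕ j)))
           (cong (+ t ℤ.*_) (sym (ind-yes (toℕ j ℕ.≤? r 1̂ ∸ 1) (level-of-1̂ j))))) ⟩
    ∑ (allFin n) (λ j → + t ℤ.* ind (toℕ j ℕ.≤? r 1̂ ∸ 1) (+ (t ^ toℕ j) ℤ.* b (1̂ , j)))
      ≡⟨ ∑-*ˡ (allFin n) (+ t) _ ⟩
    + t ℤ.* D 1̂ ∎
    where
    open ≡-Reasoning
    rearrange : ∀ β τ τʲ → β ℤ.* (τ ℤ.* τʲ) ≡ τ ℤ.* (τʲ ℤ.* β)
    rearrange = solve-∀

module RightHandSide {P : FinPoset} {0̂ 1̂ : Carrier P} {r : Carrier P → ℕ} {n : ℕ} (t : ℕ)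
                     (H : IsBoundedRankedFinPoset P 0̂ 1̂ r n) where

  open IsBoundedRankedFinPoset H
  open LeftHandSide t H
  open TreeCounting t

  ρ : Carrier P → ℕ
  ρ x = n ∸ r x

  Q : FinPoset
  Q = PdualT P 0̂ 1̂ r n t

  Q-laws : OrderLaws Q
  Q-laws = rees-laws (dual P) ρ (tree t n) length (dual-laws P P-laws) (tree-laws t n)

  q₀ : Carrier Q
  q₀ = (1̂ , [])

  Q-member⁻ : ∀ {x w} → (x , w) ∈ elems Q → length w ℕ.≤ ρ x
  Q-member⁻ xw∈Q =
    proj₂ (∈-filter⁻ (λ p → length (proj₂ p) ℕ.≤? ρ (proj₁ p)) {xs = cartesianProduct (elems P) _} xw∈Q)

  Q-member⁺ : ∀ {x w} → w ∈ elems (tree t n) → length w ℕ.≤ ρ x → (x , w) ∈ elems Q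
  Q-member⁺ {x} w∈T |w|≤ =
    ∈-filter⁺ (λ p → length (proj₂ p) ℕ.≤? ρ (proj₁ p)) (∈-cartesianProduct⁺ (complete x) w∈T) |w|≤

  ∑-Q : (f : Carrier Q → ℤ) →
    ∑ (elems Q) f ≡ ∑ (elems P) (λ x → ∑ (elems (tree t n)) (λ w → ind (length w ℕ.≤? ρ x) (f (x , w))))
  ∑-Q f = trans (∑-filter _ (cartesianProduct (elems P) (elems (tree t n))) f) (∑-cartesianProduct (elems P) _ _)

  -- The rank condition of Q: the rank difference in P* is the rank difference in P.
  Q-gap⇒ : ∀ {x y u w} → _≤_ Q (y , u) (x , w) → length w ℕ.≤ length u ℕ.+ (r y ∸ r x)
  Q-gap⇒ {x} {y} {u} {w} (x≤y , _ , gap) =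
    subst (λ d → length w ℕ.≤ length u ℕ.+ d) (∸-co-ranks n (rank-mono x≤y) (rank≤n y)) (gap⇒ (ℕP.∸-monoʳ-≤ n (rank-mono x≤y)) gap)

  Q-gap⇐ : ∀ {x y u w} → _≤_ P x y → Prefix _≡_ u w → length w ℕ.≤ length u ℕ.+ (r y ∸ r x) →
           _≤_ Q (y , u) (x , w)
  Q-gap⇐ {x} {y} {u} {w} x≤y u⊑w |w|≤ = x≤y , u⊑w , gap⇐ (ℕP.∸-monoʳ-≤ n (rank-mono x≤y))
    (subst (λ d → length w ℕ.≤ length u ℕ.+ d) (sym (∸-co-ranks n (rank-mono x≤y) (rank≤n y))) |w|≤)

  ρ1̂≡0 : ρ 1̂ ≡ 0
  ρ1̂≡0 = trans (cong (n ∸_) length≡n) (ℕP.n∸n≡0 n)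

  q₀-least : ∀ {q} → q ∈ elems Q → _≤_ Q q₀ q
  q₀-least {x , w} xw∈Q = Q-gap⇐ (1̂-max x) [] (ℕP.≤-trans (Q-member⁻ xw∈Q)
    (ℕP.≤-reflexive (trans (∸-split n (rank-mono (1̂-max x)) (rank≤n 1̂)) (cong (ℕ._+ (r 1̂ ∸ r x)) ρ1̂≡0))))

  q₀∈Q : q₀ ∈ elems Q
  q₀∈Q = Q-member⁺ (∈-concatMap⁺ (wordsOfLength t) {xs = upTo (suc n)} (here (here refl))) z≤n

  module Q⁺ = PlusBottom Q Q-laws q₀ q₀∈Q q₀-least

  μQ : Carrier Q → ℤ
  μQ = Q⁺.μ⁺

  T : Carrier P → ℤ
  T x = ∑ (elems (tree t n)) (λ w → ind (length w ℕ.≤? ρ x) (μQ (x , w)))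

  rhs-sum : - mobius (plus Q) (just q₀) nothing ≡ ∑ (elems P) T
  rhs-sum = trans (cong -_ Q⁺.μ⁺-top) (trans (ℤP.neg-involutive _) (∑-Q μQ))

  -- The elements (x, w) above (y, u) are the extensions w of u by at most  r y - r x  letters:
  --   #{w : |w| ≤ ρ x, (y,u) < (x,w)} = κ x y.
  tree-count : ∀ x y u → length u ℕ.≤ ρ y →
    ∑ (elems (tree t n)) (λ w → ind (length w ℕ.≤? ρ x) (ind (_<?_ Q (y , u) (x , w)) (+ 1))) ≡ κ x y
  tree-count x y u |u|≤ = count (_<?_ P x y)
    where
    above? : (w : Word) → Dec (length w ℕ.≤ ρ x × _<_ Q (y , u) (x , w))
    above? w = (length w ℕ.≤? ρ x) ×-dec (_<?_ Q (y , u) (x , w))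
    count : (x<?y : Dec (_<_ P x y)) →
      ∑ (elems (tree t n)) (λ w → ind (length w ℕ.≤? ρ x) (ind (_<?_ Q (y , u) (x , w)) (+ 1))) ≡ ind x<?y (S (r y ∸ r x))
    count (no x≮y) = ∑-zero (elems (tree t n)) (λ w _ → trans (sym (ind-× (length w ℕ.≤? ρ x) (_<?_ Q (y , u) (x , w)) (+ 1)))
      (ind-no (above? w) (λ (_ , yu<xw) → not-above w yu<xw)))
      where
      not-above : ∀ w → ¬ _<_ Q (y , u) (x , w)
      not-above w (yu≤xw@(x≤y , u⊑w , _) , yu≢xw) with _≟_ P x y
      ... | no x≢y = x≮y (x≤y , x≢y)
      ... | yes refl = yu≢xw (cong (x ,_) (Pointwise-≡⇒≡ (toPointwise (ℕP.≤-antisym (length-mono u⊑w)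
            (subst (length w ℕ.≤_) (trans (cong (length u ℕ.+_) (ℕP.n∸n≡0 (r x))) (ℕP.+-identityʳ (length u))) (Q-gap⇒ yu≤xw))) u⊑w)))
    count (yes (x≤y , x≢y)) = trans (∑-cong′ (elems (tree t n)) (λ w → sym (ind-× (length w ℕ.≤? ρ x) (_<?_ Q (y , u) (x , w)) (+ 1))))
      (within n u d fits above?
        (λ w (_ , yu≤xw , _) → proj₁ (proj₂ yu≤xw) , Q-gap⇒ yu≤xw)
        (λ w (u⊑w , |w|≤) → ℕP.≤-trans |w|≤ u+d≤ρx , Q-gap⇐ x≤y u⊑w |w|≤ , λ yu≡xw → x≢y (sym (cong proj₁ yu≡xw))))
      where
      d : ℕ
      d = r y ∸ r x
      u+d≤ρx : length u ℕ.+ d ℕ.≤ ρ x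
      u+d≤ρx = ℕP.≤-trans (ℕP.+-monoˡ-≤ d |u|≤) (ℕP.≤-reflexive (sym (∸-split n (rank-mono x≤y) (rank≤n y))))
      fits : length u ℕ.+ d ℕ.≤ n
      fits = ℕP.≤-trans u+d≤ρx (ℕP.m∸n≤m n (r x))

  base-count : ∀ x →
    ∑ (elems (tree t n)) (λ w → ind (length w ℕ.≤? ρ x) (ind (_≟_ Q (x , w) q₀) (+ 1))) ≡ ind (_≟_ P x 1̂) (+ 1)
  base-count x = count (_≟_ P x 1̂)
    where
    count : (x≟1̂ : Dec (x ≡ 1̂)) →
      ∑ (elems (tree t n)) (λ w → ind (length w ℕ.≤? ρ x) (ind (_≟_ Q (x , w) q₀) (+ 1))) ≡ ind x≟1̂ (+ 1)
    count (yes refl) = trans (∑-cong′ (elems (tree t n)) (λ w → sym (ind-× (length w ℕ.≤? ρ x) (_≟_ Q (x , w) q₀) (+ 1))))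
      (within n [] 0 z≤n (λ w → (length w ℕ.≤? ρ x) ×-dec (_≟_ Q (x , w) q₀))
        (λ { w (_ , refl) → [] , z≤n })
        (λ { [] _ → z≤n , refl }))
    count (no x≢1̂) = ∑-zero (elems (tree t n)) (λ w _ → trans
      (ind-congʳ (length w ℕ.≤? ρ x) (λ _ → ind-no (_≟_ Q (x , w) q₀) (λ xw≡q₀ → x≢1̂ (cong proj₁ xw≡q₀))))
      (ind-0 (length w ℕ.≤? ρ x)))

  -- Summing the recursion of μ_{Q⁺}(q₀, -) over the elements (x, w) of Q:
  --   T x = [x = 1̂] - Σ_{y ∈ P} κ x y · T y.
  T-rec : ∀ x → T x ≡ ind (_≟_ P x 1̂) (+ 1) ℤ.+ - ∑ (elems P) (λ y → κ x y ℤ.* T y)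
  T-rec x = begin
    T x
      ≡⟨ ∑-cong (elems (tree t n)) (λ w w∈T → ind-congʳ (short? w) (λ |w|≤ → Q⁺.μ⁺-rec (Q-member⁺ w∈T |w|≤))) ⟩
    ∑ (elems (tree t n)) (λ w → ind (short? w) (ind (is-q₀? w) (+ 1) ℤ.+ - ∑ (elems Q) (λ q → ind (below? w q) (μQ q))))
      ≡⟨ ∑-cong′ (elems (tree t n)) (λ w → expand (short? w) (ind (is-q₀? w) (+ 1)) (below? w)) ⟩
    ∑ (elems (tree t n)) (λ w → ind (short? w) (ind (is-q₀? w) (+ 1)) ℤ.+ - ∑ (elems Q) (λ q → ind (short? w) (ind (below? w q) (+ 1)) ℤ.* μQ q))
      ≡⟨ trans (∑-+ (elems (tree t n)) (λ w → ind (short? w) (ind (is-q₀? w) (+ 1))) (λ w → - ∑ (elems Q) (term w)))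
               (cong₂ ℤ._+_ (base-count x) (∑-neg (elems (tree t n)) (λ w → ∑ (elems Q) (term w)))) ⟩
    ind (_≟_ P x 1̂) (+ 1) ℤ.+ - ∑ (elems (tree t n)) (λ w → ∑ (elems Q) (λ q → ind (short? w) (ind (below? w q) (+ 1)) ℤ.* μQ q))
      ≡⟨ cong (λ s → ind (_≟_ P x 1̂) (+ 1) ℤ.+ - s) (trans (∑-swap (elems (tree t n)) (elems Q) term)
           (trans (∑-cong′ (elems Q) (λ q → ∑-*ʳ (elems (tree t n)) (λ w → ind (short? w) (ind (below? w q) (+ 1))) (μQ q)))
                  (∑-Q (λ q → weight q ℤ.* μQ q)))) ⟩
    ind (_≟_ P x 1̂) (+ 1) ℤ.+ - ∑ (elems P) (λ y → ∑ (elems (tree t n)) (λ u → ind (length u ℕ.≤? ρ y) (weight (y , u) ℤ.* μQ (y , u))))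
      ≡⟨ cong (λ s → ind (_≟_ P x 1̂) (+ 1) ℤ.+ - s) (∑-cong′ (elems P) per-element) ⟩
    ind (_≟_ P x 1̂) (+ 1) ℤ.+ - ∑ (elems P) (λ y → κ x y ℤ.* T y) ∎
    where
    open ≡-Reasoning
    short? : (w : Word) → Dec (length w ℕ.≤ ρ x)
    short? w = length w ℕ.≤? ρ x
    is-q₀? : (w : Word) → Dec ((x , w) ≡ q₀)
    is-q₀? w = _≟_ Q (x , w) q₀
    below? : (w : Word) (q : Carrier Q) → Dec (_<_ Q q (x , w))
    below? w q = _<?_ Q q (x , w)
    term : Word → Carrier Q → ℤ
    term w q = ind (short? w) (ind (below? w q) (+ 1)) ℤ.* μQ q
    weight : Carrier Q → ℤ
    weight q = ∑ (elems (tree t n)) (λ w → ind (short? w) (ind (below? w q) (+ 1)))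

    expand : ∀ {A : Set} {B : Carrier Q → Set} (c : Dec A) (a : ℤ) (B? : ∀ q → Dec (B q)) →
      ind c (a ℤ.+ - ∑ (elems Q) (λ q → ind (B? q) (μQ q)))
      ≡ ind c a ℤ.+ - ∑ (elems Q) (λ q → ind c (ind (B? q) (+ 1)) ℤ.* μQ q)
    expand (no _)  a B? = sym (trans (ℤP.+-identityˡ _) (cong -_ (∑-zero (elems Q) (λ _ _ → refl))))
    expand (yes _) a B? = cong (λ s → a ℤ.+ - s) (∑-cong′ (elems Q) (λ q →
      trans (cong (ind (B? q)) (sym (ℤP.*-identityˡ (μQ q)))) (ind-*ʳ (B? q) (+ 1) (μQ q))))

    per-element : ∀ y →
      ∑ (elems (tree t n)) (λ u → ind (length u ℕ.≤? ρ y) (weight (y , u) ℤ.* μQ (y , u))) ≡ κ x y ℤ.* T y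
    per-element y = trans (∑-cong′ (elems (tree t n)) (λ u → trans
        (ind-congʳ (length u ℕ.≤? ρ y) (λ |u|≤ → cong (ℤ._* μQ (y , u)) (tree-count x y u |u|≤)))
        (ind-*ˡ (length u ℕ.≤? ρ y) (κ x y) _)))
      (∑-*ˡ (elems (tree t n)) (κ x y) _)

  δ : Carrier P → ℤ
  δ x = ind (_≟_ P x 1̂) (+ 1)

  private
    ∑-P⁻ : (f : Carrier P → ℤ) → ∑ P⁻ f ≡ ∑ (elems P) (λ y → ind (¬? (_≟_ P y 0̂)) (f y))
    ∑-P⁻ = ∑-filter (λ y → ¬? (_≟_ P y 0̂)) (elems P)

    above-0̂ : ∀ {x y} → _<_ P x y → ¬ y ≡ 0̂
    above-0̂ {x} (x≤y , x≢y) refl = x≢y (≤-antisym P-laws x≤y (0̂-min x))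

  -- Nothing lies strictly below 0̂, so the recursion of T on P⁻ only involves P⁻.
  T-rec-P⁻ : ∀ x → ∑ P⁻ (λ y → κ x y ℤ.* T y) ≡ δ x ℤ.+ - T x
  T-rec-P⁻ x = trans (∑-P⁻ _) (trans (∑-cong′ (elems P) drop-0̂) (solve-for-sum {d = δ x} (T-rec x)))
    where
    drop-0̂ : ∀ y → ind (¬? (_≟_ P y 0̂)) (κ x y ℤ.* T y) ≡ κ x y ℤ.* T y
    drop-0̂ y with _<?_ P x y
    ... | yes x<y = ind-yes (¬? (_≟_ P y 0̂)) (above-0̂ x<y)
    ... | no _    = ind-0 (¬? (_≟_ P y 0̂))
    solve-for-sum : ∀ {τ d k} → τ ≡ d ℤ.+ - k → k ≡ d ℤ.+ - τ
    solve-for-sum {d = d} {k} refl = eq d k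
      where
      eq : ∀ d k → k ≡ d ℤ.+ - (d ℤ.+ - k)
      eq = solve-∀

  -- Splitting off 0̂ and using the recursion of T at 0̂:  Σ_P T = -t · Σ_{y ∈ P⁻} S(r y - 1) · T y.
  ∑-T : ¬ 0̂ ≡ 1̂ → ∑ (elems P) T ≡ - (+ t ℤ.* ∑ P⁻ (λ y → S (r y ∸ 1) ℤ.* T y))
  ∑-T 0̂≢1̂ = begin
    ∑ (elems P) T
      ≡⟨ ∑-split (elems P) T (λ y → _≟_ P y 0̂) ⟩
    ∑ (elems P) (λ y → ind (_≟_ P y 0̂) (T y)) ℤ.+ ∑ (elems P) (λ y → ind (nonzero? y) (T y))
      ≡⟨ cong (ℤ._+ ∑ (elems P) (λ y → ind (nonzero? y) (T y))) (trans
           (∑-delta (elems P) 0̂ _ unique (complete 0̂) (λ y _ y≢0̂ → ind-no (_≟_ P y 0̂) y≢0̂))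
           (trans (ind-yes (_≟_ P 0̂ 0̂) refl) T-0̂)) ⟩
    - ∑ (elems P) (λ y → ind (nonzero? y) (S (r y) ℤ.* T y)) ℤ.+ ∑ (elems P) (λ y → ind (nonzero? y) (T y))
      ≡⟨ trans (cong (ℤ._+ ∑ (elems P) (λ y → ind (nonzero? y) (T y))) (sym (∑-neg (elems P) _))) (sym (∑-+ (elems P) _ _)) ⟩
    ∑ (elems P) (λ y → - ind (nonzero? y) (S (r y) ℤ.* T y) ℤ.+ ind (nonzero? y) (T y))
      ≡⟨ ∑-cong′ (elems P) (λ y → per-element y (nonzero? y)) ⟩
    ∑ (elems P) (λ y → - (+ t ℤ.* ind (nonzero? y) (S (r y ∸ 1) ℤ.* T y)))
      ≡⟨ trans (∑-neg (elems P) _) (cong -_ (trans (∑-*ˡ (elems P) (+ t) _) (cong (+ t ℤ.*_) (sym (∑-P⁻ _))))) ⟩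
    - (+ t ℤ.* ∑ P⁻ (λ y → S (r y ∸ 1) ℤ.* T y)) ∎
    where
    open ≡-Reasoning
    nonzero? : ∀ y → Dec (¬ y ≡ 0̂)
    nonzero? y = ¬? (_≟_ P y 0̂)
    -- above 0̂ are exactly the nonzero elements, and r 0̂ = 0
    T-0̂ : T 0̂ ≡ - ∑ (elems P) (λ y → ind (nonzero? y) (S (r y) ℤ.* T y))
    T-0̂ = trans (T-rec 0̂) (trans (drop-zeroˡ _ (ind-no (_≟_ P 0̂ 1̂) 0̂≢1̂)) (cong -_ (∑-cong′ (elems P) (λ y →
      trans (sym (ind-*ʳ (_<?_ P 0̂ y) _ (T y))) (ind-⇔ (_<?_ P 0̂ y) (nonzero? y)
        (λ (_ , 0̂≢y) y≡0̂ → 0̂≢y (sym y≡0̂)) (λ y≢0̂ → 0̂-min y , λ 0̂≡y → y≢0̂ (sym 0̂≡y))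
        (cong (λ ρ₀ → S (r y ∸ ρ₀) ℤ.* T y) rank-0̂))))))
    per-element : ∀ y (y≢0̂? : Dec (¬ y ≡ 0̂)) →
      - ind y≢0̂? (S (r y) ℤ.* T y) ℤ.+ ind y≢0̂? (T y) ≡ - (+ t ℤ.* ind y≢0̂? (S (r y ∸ 1) ℤ.* T y))
    per-element y (no _)    = sym (cong -_ (ℤP.*-zeroʳ (+ t)))
    per-element y (yes y≢0̂) =
      trans (cong (λ σ → - (σ ℤ.* T y) ℤ.+ T y) (S-pred (rank≥1 y≢0̂))) (eq (+ t) (S (r y ∸ 1)) (T y))
      where
      eq : ∀ τ σ θ → - ((+ 1 ℤ.+ τ ℤ.* σ) ℤ.* θ) ℤ.+ θ ≡ - (τ ℤ.* (σ ℤ.* θ))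
      eq = solve-∀

-- The right-hand side is  t · D 1̂ as well: the systems for D and T pair off, and the delta at 1̂
-- picks out D 1̂.
module _ {P : FinPoset} {0̂ 1̂ : Carrier P} {r : Carrier P → ℕ} {n : ℕ} (t : ℕ)
         (H : IsBoundedRankedFinPoset P 0̂ 1̂ r n) (n≥1 : n ≥ 1) where

  open IsBoundedRankedFinPoset H
  open LeftHandSide t H
  open RightHandSide t H

  rhs-≡ : - mobius (plus Q) (just q₀) nothing ≡ + t * D 1̂
  rhs-≡ = begin
    - mobius (plus Q) (just q₀) nothing
      ≡⟨ rhs-sum ⟩
    ∑ (elems P) T
      ≡⟨ ∑-T (λ 0̂≡1̂ → 1̂≢0̂ n≥1 (sym 0̂≡1̂)) ⟩
    - (+ t * ∑ P⁻ (λ y → S (r y ∸ 1) * T y))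
      ≡⟨ cong (λ v → - (+ t * v)) (∑-pairing P⁻ κ D T (λ y → S (r y ∸ 1)) δ (λ y → D-rec) (λ x _ → T-rec-P⁻ x)) ⟩
    - (+ t * - ∑ P⁻ (λ x → D x * δ x))
      ≡⟨ cong (λ v → - (+ t * - v)) D-at-1̂ ⟩
    - (+ t * - D 1̂)
      ≡⟨ neg-neg (+ t) (D 1̂) ⟩
    + t * D 1̂ ∎
    where
    open ≡-Reasoning
    neg-neg : ∀ a b → - (a * - b) ≡ a * b
    neg-neg = solve-∀
    D-at-1̂ : ∑ P⁻ (λ x → D x * δ x) ≡ D 1̂
    D-at-1̂ = trans (∑-delta P⁻ 1̂ _ (filter⁺ (λ x → ¬? (_≟_ P x 0̂)) unique)
                     (∈-filter⁺ (λ x → ¬? (_≟_ P x 0̂)) (complete 1̂) (1̂≢0̂ n≥1))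
                     (λ x _ x≢1̂ → trans (cong (D x *_) (ind-no (_≟_ P x 1̂) x≢1̂)) (ℤP.*-zeroʳ (D x))))
                   (trans (cong (D 1̂ *_) (ind-yes (_≟_ P 1̂ 1̂) refl)) (ℤP.*-identityʳ (D 1̂)))

theorem8p7 : (P : FinPoset) (0̂ 1̂ : Carrier P) (r : Carrier P → ℕ) (n t : ℕ) →
    IsBoundedRankedFinPoset P 0̂ 1̂ r n → n ≥ 1 → t ≥ 1 →
    sumℤ (map (λ j → μhat (I P 0̂ 1̂ r n j) * (+ (t ^ suc (toℕ j)))) (allFin n))
      ≡ - mobius (plus (PdualT P 0̂ 1̂ r n t)) (just (1̂ , [])) nothing
theorem8p7 P 0̂ 1̂ r n t H n≥1 _ = trans (lhs-≡ (1̂≢0̂ n≥1)) (sym (rhs-≡ t H n≥1))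
  where
  open LeftHandSide t H
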